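{- Let $k\geq3$ and $n\geq4$ with $n=2^tm$, where $t>0$ and $m$ is odd. Let $\delta=1$ if $k$ is odd and $\delta=2$ if $k$ is even. Then: (i) $|N_0(n,k)| = \frac{\delta}{2} (\delta k^{(n-2)/2}-k^{(m-1)/2})$; (ii) $|N_1(n,k)| = \delta k^{(m-1)/2}$, and every circuit in $N_1(n,k)$ has period dividing $m$; (iii) $|N_2(n,k)| = \frac{k^{n/2}-\delta k^{(m-1)/2}}{2}$.
   Context: Tuples are $k$-ary (entries in $\mathbb{Z}_k$), negation is modulo $k$, $\mathbf{u}^R$ is the reverse of $\mathbf{u}$; a tuple $\mathbf{u}$ is negasymmetric if $\mathbf{u}=-\mathbf{u}^R$. The pseudoweight of $a\in\mathbb{Z}_k$ is $a$ if $a\ne0$ and $k/2$ if $a=0$, and of a tuple the sum over its entries. $B_k(n-1)$ is the de Bruijn digraph with vertices the $k$-ary $(n-1)$-tuples and edges the $k$-ary $n$-tuples $(a_0,\dots,a_{n-1})$ from $(a_0,\dots,a_{n-2})$ to $(a_1,\dots,a_{n-1})$; $H_k(n-1)$ is its subgraph of edges of pseudoweight exactly $kn/2$. For an $n$-tuple $(a_0,\dots,a_{n-1})$, with $p$ the least positive $c$ such that $a_i=a_{(i+c)\bmod n}$ for all $i$, $[a_0,\dots,a_{n-1}]$ is the circuit whose edges are the $p$ cyclic shifts $(a_j,\dots,a_{j+n-1})$ (indices mod $n$), $0\le j<p$; $p$ is its period. $\mathcal{C}_k(n-1)$ is the set of such circuits arising from edges of $H_k(n-1)$. A circuit is negasymmetric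 if it contains edges $\mathbf a,\mathbf b$ (not necessarily distinct) with $\mathbf a=-\mathbf b^R$. $N_i(n,k)$ is the set of negasymmetric circuits in $\mathcal{C}_k(n-1)$ containing exactly $i$ negasymmetric $n$-tuples among their edges. -}

module Defs where

open import Data.Nat using (ℕ; zero; suc; _+_; _*_; _≟_)
open import Data.Nat.DivMod using (_%_)
open import Data.Fin using (Fin; zero; suc; toℕ; opposite)
open import Data.Fin.Properties using () renaming (_≟_ to _≟ᶠ_)
open import Data.Vec using (Vec; []; _∷_; _∷ʳ_; reverse; toList)
import Data.Vec as V
open import Data.Vec.Properties using (≡-dec)
open import Data.List using (List; []; _∷_; upTo; allFin; concatMap; filter; length; deduplicate; map)
open import Data.Nat.ListAction using (sum)
open import Data.List.Relation.Unary.Any using (Any; any?)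
open import Relation.Binary.PropositionalEquality using (_≡_)
open import Relation.Nullary using (Dec; ¬_)
open import Relation.Nullary.Decidable using (_×-dec_)
open import Data.Product using (_×_)

Tuple : ℕ → ℕ → Set
Tuple k n = Vec (Fin k) n

-- negation modulo k :  -0 = 0,  -(i+1) = k - (i+1) = suc (opposite i)
neg : ∀ {k} → Fin k → Fin k
neg zero    = zero
neg (suc i) = suc (opposite i)

negRev : ∀ {k n} → Tuple k n → Tuple k n
negRev u = V.map neg (reverse u)

NegSym : ∀ {k n} → Tuple k n → Set
NegSym u = u ≡ negRev u

negSym? : ∀ {k n} (u : Tuple k n) → Dec (NegSym u)
negSym? u = ≡-dec _≟ᶠ_ u (negRev u)

-- TWICE the pseudoweight of an entry (avoids k/2 for odd k):
-- 2·pw(0) = k, 2·pw(a) = 2a for a ≠ 0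
pw2 : ∀ {k} → Fin k → ℕ
pw2 {k} zero = k
pw2 (suc i)  = 2 * toℕ (suc i)

pseudoweight2 : ∀ {k n} → Tuple k n → ℕ
pseudoweight2 u = sum (map pw2 (toList u))

-- edge of H_k(n-1): pseudoweight exactly kn/2, i.e. twice it equals k*n
InH : ∀ {k n} → Tuple k n → Set
InH {k} {n} u = pseudoweight2 u ≡ k * n

inH? : ∀ {k n} (u : Tuple k n) → Dec (InH u)
inH? {k} {n} u = pseudoweight2 u ≟ k * n

allTuples : ∀ k n → List (Tuple k n)
allTuples k zero    = [] ∷ []
allTuples k (suc n) = concatMap (λ a → map (a ∷_) (allTuples k n)) (allFin k)

rot1 : ∀ {A : Set} {n} → Vec A n → Vec A n
rot1 []       = []
rot1 (x ∷ xs) = xs ∷ʳ x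

rot : ∀ {A : Set} {n} → ℕ → Vec A n → Vec A n
rot zero    u = u
rot (suc j) u = rot1 (rot j u)

firstOr : ℕ → List ℕ → ℕ
firstOr d []      = d
firstOr d (x ∷ _) = x

-- period: least positive c (c ≤ n; c = n always works) with rot c u = u,
-- i.e. a_i = a_{(i+c) mod n} for all i
period : ∀ {k n} → Tuple k n → ℕ
period {k} {n} u = firstOr n (filter (λ c → ≡-dec _≟ᶠ_ (rot c u) u) (map suc (upTo n)))

edges : ∀ {k n} → Tuple k n → List (Tuple k n)
edges u = map (λ j → rot j u) (upTo (period u))

NegSymCircuit : ∀ {k n} → Tuple k n → Set
NegSymCircuit u = Any (λ a → Any (λ b → a ≡ negRev b) (edges u)) (edges u)

negSymCircuit? : ∀ {k n} (u : Tuple k n) → Dec (NegSymCircuit u)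
negSymCircuit? u = any? (λ a → any? (λ b → ≡-dec _≟ᶠ_ a (negRev b)) (edges u)) (edges u)

numNegSymEdges : ∀ {k n} → Tuple k n → ℕ
numNegSymEdges u = length (filter negSym? (edges u))

SameCircuit : ∀ {k n} → Tuple k n → Tuple k n → Set
SameCircuit {n = n} u v = Any (λ j → v ≡ rot j u) (upTo n)

sameCircuit? : ∀ {k n} (u v : Tuple k n) → Dec (SameCircuit u v)
sameCircuit? {n = n} u v = any? (λ j → ≡-dec _≟ᶠ_ v (rot j u)) (upTo n)

-- C_k(n-1): one representative edge per circuit [u], u an edge of H_k(n-1)
circuits : ∀ k n → List (Tuple k n)
circuits k n = deduplicate sameCircuit? (filter inH? (allTuples k n))

N : ℕ → ∀ k n → List (Tuple k n)
N i k n = filter (λ u → negSymCircuit? u ×-dec (numNegSymEdges u ≟ i)) (circuits k n)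

δ : ℕ → ℕ
δ k with k % 2
... | zero = 2
... | suc _ = 1

{-# OPTIONS --safe #-}
-- If the circuit [u] of period p is negasymmetric, say −uᴿ = rot s u, then its edge rot j u is negasymmetric
-- exactly when 2j ≡ s (mod p), and satisfies v = rot1 (−vᴿ) exactly when 2j ≡ s + 1 (mod p).  So the circuit
-- has one edge of each kind when p is odd, and two of one kind and none of the other when p is even, while a
-- circuit that is not negasymmetric has none.  Since p ∣ n, p is odd exactly when p ∣ m, i.e. when the edges
-- are m-periodic.  All these tuples have pseudoweight kn/2 and the circuits of C_k(n−1) partition the edges
-- of H_k(n−1), so summing over the circuits gives
--   |N₁| + 2|N₂| = #{negasymmetric n-tuples}                        = k^(n/2),
--   2|N₀| + |N₁| = #{n-tuples v with v = rot1 (−vᴿ)}                = δ² k^((n−2)/2),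
--   |N₁|         = #{negasymmetric n-tuples of period dividing m}   = #{negasymmetric m-tuples} = δ k^((m−1)/2).

module Submission where

open import Defs
open import Data.Bool using (Bool; true; false; _∧_; _∨_; not; if_then_else_)
open import Data.Bool.ListAction using (any)
open import Data.Bool.Properties using (∧-identityʳ; ∧-zeroʳ; ∧-conicalˡ; ∨-zeroʳ; not-involutive)
open import Data.Empty using (⊥-elim)
open import Data.Fin using (Fin; zero; suc; toℕ; opposite; fromℕ<)
open import Data.Fin.Properties using (opposite-involutive; opposite-prop; toℕ<n; toℕ-injective; toℕ-fromℕ<) renaming (_≟_ to _≟ᶠ_)
open import Data.List using (List; []; _∷_; _++_; map; concatMap; filter; length; upTo; applyUpTo; allFin; deduplicate; reverse)
import Data.List.Properties as Listₚ
import Data.List.Membership.DecPropositional as DecMembership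
open import Data.List.Membership.Propositional using (_∈_; _∉_; find; lose)
open import Data.List.Membership.Propositional.Properties using (∈-allFin; ∈-upTo⁺; ∈-upTo⁻; ∈-concatMap⁺; ∈-map⁺; ∈-filter⁺; ∈-filter⁻)
open import Data.List.Relation.Binary.Permutation.Propositional using (_↭_; ↭-refl)
import Data.List.Relation.Binary.Permutation.Propositional.Properties as ↭ₚ
import Data.List.Relation.Unary.All as All
open import Data.List.Relation.Unary.Any using (Any; here; there; any?)
import Data.List.Relation.Unary.Any.Properties as Anyₚ
open import Data.List.Relation.Unary.Unique.Propositional using (Unique; []; _∷_)
open import Data.List.Relation.Unary.Unique.Propositional.Properties using (allFin⁺; upTo⁺)
import Data.List.Relation.Unary.Unique.Propositional.Properties as Uniqueₚ
open import Data.Nat using (ℕ; zero; suc; _+_; _*_; _∸_; _^_; _≤_; _<_; s≤s; z<s; NonZero; >-nonZero; _≟_)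
open import Data.Nat.DivMod using (_/_; _%_; m≡m%n+[m/n]*n; m%n<n; m<n⇒m%n≡m; m*n%n≡0; m*n/n≡m; [m+kn]%n≡m%n; [m+n]%n≡m%n; n%n≡0)
open import Data.Nat.Divisibility using (_∣_; divides; m%n≡0⇒n∣m)
open import Data.Nat.ListAction using (sum)
open import Data.Nat.ListAction.Properties using (sum-++; sum-↭)
open import Data.Nat.Properties
open import Algebra.Properties.CommutativeSemigroup +-commutativeSemigroup using (interchange)
open import Data.Product using (_×_; _,_; proj₁; proj₂; ∃)
open import Data.Sum using (inj₁; inj₂)
open import Data.Vec as Vec using (Vec; []; _∷_; toList)
import Data.Vec.Properties as Vecₚ
open import Data.Vec.Relation.Binary.Equality.Cast using (cast-is-id)
open import Function using (_∘_; _⇔_; mk⇔; Equivalence)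
import Function.Properties.Equivalence as ⇔
open import Level using (0ℓ)
open import Relation.Binary using (Rel; Decidable; DecidableEquality; Symmetric; Transitive; tri<; tri≈; tri>)
open import Relation.Binary.PropositionalEquality
open import Relation.Nullary using (Dec; yes; no; does; ¬_; ¬?)
open import Relation.Nullary.Decidable using (dec-true; dec-false; does-⇔; _×-dec_)

-- Sums and counts over lists

does≡true⇒ : ∀ {P : Set} (P? : Dec P) → does P? ≡ true → P
does≡true⇒ (yes p) _ = p

ind : Bool → ℕ
ind true  = 1
ind false = 0

∑ : {A : Set} → (A → ℕ) → List A → ℕ
∑ f xs = sum (map f xs)

count : {A : Set} → (A → Bool) → List A → ℕ
count p = ∑ (ind ∘ p)

module _ {A : Set} where

  ∑-cong : ∀ {f g : A → ℕ} xs → (∀ x → x ∈ xs → f x ≡ g x) → ∑ f xs ≡ ∑ g xs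
  ∑-cong []       f≗g = refl
  ∑-cong (x ∷ xs) f≗g = cong₂ _+_ (f≗g x (here refl)) (∑-cong xs (λ y y∈xs → f≗g y (there y∈xs)))

  ∑-const : ∀ c (xs : List A) → ∑ (λ _ → c) xs ≡ c * length xs
  ∑-const c []       = sym (*-zeroʳ c)
  ∑-const c (x ∷ xs) = trans (cong (c +_) (∑-const c xs)) (sym (*-suc c (length xs)))

  ∑-+ : ∀ (f g : A → ℕ) xs → ∑ (λ x → f x + g x) xs ≡ ∑ f xs + ∑ g xs
  ∑-+ f g []       = refl
  ∑-+ f g (x ∷ xs) = trans (cong (f x + g x +_) (∑-+ f g xs)) (interchange (f x) (g x) (∑ f xs) (∑ g xs))

  ∑-*ˡ : ∀ c (f : A → ℕ) xs → ∑ (λ x → c * f x) xs ≡ c * ∑ f xs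
  ∑-*ˡ c f []       = sym (*-zeroʳ c)
  ∑-*ˡ c f (x ∷ xs) = trans (cong (c * f x +_) (∑-*ˡ c f xs)) (sym (*-distribˡ-+ c (f x) (∑ f xs)))

  ∑-++ : ∀ (f : A → ℕ) xs ys → ∑ f (xs ++ ys) ≡ ∑ f xs + ∑ f ys
  ∑-++ f xs ys = trans (cong sum (Listₚ.map-++ f xs ys)) (sum-++ (map f xs) (map f ys))

  ∑-filter : ∀ {P : A → Set} (P? : ∀ x → Dec (P x)) (f : A → ℕ) xs →
             ∑ f (filter P? xs) ≡ ∑ (λ x → if does (P? x) then f x else 0) xs
  ∑-filter P? f []       = refl
  ∑-filter P? f (x ∷ xs) with does (P? x)
  ... | true  = cong (f x +_) (∑-filter P? f xs)
  ... | false = ∑-filter P? f xs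

  length-filter : ∀ {P : A → Set} (P? : ∀ x → Dec (P x)) xs → length (filter P? xs) ≡ count (does ∘ P?) xs
  length-filter P? []       = refl
  length-filter P? (x ∷ xs) with does (P? x)
  ... | true  = cong suc (length-filter P? xs)
  ... | false = length-filter P? xs

ind-∨-∧ : ∀ a b q → ind ((a ∨ b) ∧ q) ≡ ind (a ∧ q) + ind (b ∧ (not a ∧ q))
ind-∨-∧ true  true  q = sym (+-identityʳ (ind q))
ind-∨-∧ true  false q = sym (+-identityʳ (ind q))
ind-∨-∧ false b     q = refl

count-∧-const : ∀ {A : Set} (q : A → Bool) c xs → count (λ x → q x ∧ c) xs ≡ (if c then count q xs else 0)
count-∧-const q true  xs = ∑-cong xs (λ x _ → cong ind (∧-identityʳ (q x)))
count-∧-const q false xs = trans (∑-cong xs (λ x _ → cong ind (∧-zeroʳ (q x)))) (∑-const 0 xs)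

if-then-0 : ∀ b c → (if b then c else 0) ≡ c * ind b
if-then-0 true  c = sym (*-identityʳ c)
if-then-0 false c = sym (*-zeroʳ c)

ind-not : ∀ b → ind b + ind (not b) ≡ 1
ind-not true  = refl
ind-not false = refl

module _ {A B : Set} where

  ∑-map : ∀ (f : B → ℕ) (h : A → B) xs → ∑ f (map h xs) ≡ ∑ (f ∘ h) xs
  ∑-map f h xs = cong sum (sym (Listₚ.map-∘ xs))

  ∑-concatMap : ∀ (f : B → ℕ) (h : A → List B) xs → ∑ f (concatMap h xs) ≡ ∑ (λ x → ∑ f (h x)) xs
  ∑-concatMap f h []       = refl
  ∑-concatMap f h (x ∷ xs) = trans (∑-++ f (h x) (concatMap h xs)) (cong (∑ f (h x) +_) (∑-concatMap f h xs))

module _ {A : Set} (_≟_ : DecidableEquality A) where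

  count-≡-∉ : ∀ {x} xs → x ∉ xs → count (λ y → does (y ≟ x)) xs ≡ 0
  count-≡-∉ {x} []       x∉xs = refl
  count-≡-∉ {x} (y ∷ xs) x∉xs
    rewrite dec-false (y ≟ x) (λ y≡x → x∉xs (here (sym y≡x))) = count-≡-∉ xs (x∉xs ∘ there)

  count-≡-unique : ∀ {x xs} → Unique xs → x ∈ xs → count (λ y → does (y ≟ x)) xs ≡ 1
  count-≡-unique {x} {y ∷ xs} (y∉xs ∷ _) (here refl)
    rewrite dec-true (x ≟ x) refl = cong suc (count-≡-∉ xs (λ x∈xs → All.lookup y∉xs x∈xs refl))
  count-≡-unique {x} {y ∷ xs} (y∉xs ∷ xs!) (there x∈xs)
    rewrite dec-false (y ≟ x) (λ { refl → All.lookup y∉xs x∈xs refl }) = count-≡-unique xs! x∈xs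

-- Enumerating tuples

_≟ᵛ_ : ∀ {k n} → DecidableEquality (Tuple k n)
_≟ᵛ_ = Vecₚ.≡-dec _≟ᶠ_

module _ (k : ℕ) where

  ∑-allTuples-suc : ∀ {n} (f : Tuple k (suc n) → ℕ) →
                    ∑ f (allTuples k (suc n)) ≡ ∑ (λ c → ∑ (λ v → f (c ∷ v)) (allTuples k n)) (allFin k)
  ∑-allTuples-suc {n} f =
    trans (∑-concatMap f _ (allFin k)) (∑-cong (allFin k) (λ c _ → ∑-map f (c ∷_) (allTuples k n)))

  ∑-allTuples-++ : ∀ a {b} (f : Tuple k (a + b) → ℕ) →
                   ∑ f (allTuples k (a + b)) ≡ ∑ (λ x → ∑ (λ y → f (x Vec.++ y)) (allTuples k b)) (allTuples k a)
  ∑-allTuples-++ zero    f = sym (+-identityʳ _)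
  ∑-allTuples-++ (suc a) {b} f = begin
      ∑ f (allTuples k (suc a + b))
    ≡⟨ ∑-allTuples-suc f ⟩
      ∑ (λ c → ∑ (λ v → f (c ∷ v)) (allTuples k (a + b))) (allFin k)
    ≡⟨ ∑-cong (allFin k) (λ c _ → ∑-allTuples-++ a (λ v → f (c ∷ v))) ⟩
      ∑ (λ c → ∑ (λ x → ∑ (λ y → f (c ∷ x Vec.++ y)) (allTuples k b)) (allTuples k a)) (allFin k)
    ≡⟨ sym (∑-allTuples-suc (λ x → ∑ (λ y → f (x Vec.++ y)) (allTuples k b))) ⟩
      ∑ (λ x → ∑ (λ y → f (x Vec.++ y)) (allTuples k b)) (allTuples k (suc a)) ∎
    where open ≡-Reasoning

  ∑-const-allTuples : ∀ n c → ∑ (λ _ → c) (allTuples k n) ≡ c * k ^ n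
  ∑-const-allTuples zero    c = trans (+-identityʳ c) (sym (*-identityʳ c))
  ∑-const-allTuples (suc n) c = begin
      ∑ (λ _ → c) (allTuples k (suc n))
    ≡⟨ ∑-allTuples-suc (λ _ → c) ⟩
      ∑ (λ _ → ∑ (λ _ → c) (allTuples k n)) (allFin k)
    ≡⟨ ∑-cong (allFin k) (λ _ _ → ∑-const-allTuples n c) ⟩
      ∑ (λ _ → c * k ^ n) (allFin k)
    ≡⟨ ∑-const (c * k ^ n) (allFin k) ⟩
      c * k ^ n * length (allFin k)
    ≡⟨ cong (c * k ^ n *_) (Listₚ.length-tabulate (λ i → i)) ⟩
      c * k ^ n * k
    ≡⟨ *-assoc c (k ^ n) k ⟩
      c * (k ^ n * k)
    ≡⟨ cong (c *_) (*-comm (k ^ n) k) ⟩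
      c * k ^ suc n ∎
    where open ≡-Reasoning

  count-≡-allTuples : ∀ n (c : Tuple k n) → count (λ v → does (v ≟ᵛ c)) (allTuples k n) ≡ 1
  count-≡-allTuples zero    []       = refl
  count-≡-allTuples (suc n) (c ∷ cs) =
    trans (∑-allTuples-suc (λ v → ind (does (v ≟ᵛ (c ∷ cs)))))
          (trans (∑-cong (allFin k) (λ a _ → head-case a)) (count-≡-unique _≟ᶠ_ (allFin⁺ k) (∈-allFin c)))
    where
      head-case : ∀ a → count (λ v → does ((a ∷ v) ≟ᵛ (c ∷ cs))) (allTuples k n) ≡ ind (does (a ≟ᶠ c))
      head-case a with a ≟ᶠ c
      ... | yes refl = count-≡-allTuples n cs
      ... | no _     = ∑-const 0 (allTuples k n)

-- Counting through representatives

module Enumeration {A : Set} (_≟_ : DecidableEquality A) (M : List A)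
                   (M-once : ∀ x → count (λ y → does (y ≟ x)) M ≡ 1) where

  open DecMembership _≟_ using (_∈?_)

  count-unique : ∀ (Q : A → Bool) {B} → Unique B → count Q B ≡ count (λ v → does (v ∈? B) ∧ Q v) M
  count-unique Q {[]}    []          = sym (∑-const 0 M)
  count-unique Q {b ∷ B} (b∉B ∷ B!) = begin
      ind (Q b) + count Q B
    ≡⟨ cong₂ _+_ (sym (count-≡-and (Q b))) (count-unique Q B!) ⟩
      count (λ v → does (v ≟ b) ∧ Q b) M + count (λ v → does (v ∈? B) ∧ Q v) M
    ≡⟨ sym (∑-+ _ _ M) ⟩
      ∑ (λ v → ind (does (v ≟ b) ∧ Q b) + ind (does (v ∈? B) ∧ Q v)) M
    ≡⟨ ∑-cong M (λ v _ → split v) ⟩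
      count (λ v → does (v ∈? (b ∷ B)) ∧ Q v) M ∎
    where
      open ≡-Reasoning
      count-≡-and : ∀ q → count (λ v → does (v ≟ b) ∧ q) M ≡ ind q
      count-≡-and true  = trans (∑-cong M (λ v _ → cong ind (∧-identityʳ _))) (M-once b)
      count-≡-and false = trans (∑-cong M (λ v _ → cong ind (∧-zeroʳ _))) (∑-const 0 M)
      split : ∀ v → ind (does (v ≟ b) ∧ Q b) + ind (does (v ∈? B) ∧ Q v) ≡ ind (does (v ∈? (b ∷ B)) ∧ Q v)
      split v with v ≟ b
      ... | yes refl rewrite dec-false (v ∈? B) (λ v∈B → All.lookup b∉B v∈B refl) = +-identityʳ _
      ... | no _     = refl

module _ {A : Set} {R : Rel A 0ℓ} (R? : Decidable R) (R-sym : Symmetric R) (R-trans : Transitive R) where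

  private
    r : A → A → Bool
    r u v = does (R? u v)

  ∑-count-deduplicate : ∀ (M L : List A) (Q : A → Bool) →
    ∑ (λ u → count (λ v → r u v ∧ Q v) M) (deduplicate R? L) ≡ count (λ v → any (λ w → r w v) L ∧ Q v) M
  ∑-count-deduplicate M []      Q = sym (∑-const 0 M)
  ∑-count-deduplicate M (x ∷ L) Q = begin
      count (λ v → r x v ∧ Q v) M + ∑ (λ u → count (λ v → r u v ∧ Q v) M) (filter (¬? ∘ R? x) (deduplicate R? L))
    ≡⟨ cong (count (λ v → r x v ∧ Q v) M +_) (trans (∑-filter (¬? ∘ R? x) _ (deduplicate R? L))
                                                    (∑-cong (deduplicate R? L) (λ u _ → outside-class u))) ⟩
      count (λ v → r x v ∧ Q v) M + ∑ (λ u → count (λ v → r u v ∧ (not (r x v) ∧ Q v)) M) (deduplicate R? L)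
    ≡⟨ cong (count (λ v → r x v ∧ Q v) M +_) (∑-count-deduplicate M L (λ v → not (r x v) ∧ Q v)) ⟩
      count (λ v → r x v ∧ Q v) M + count (λ v → any (λ w → r w v) L ∧ (not (r x v) ∧ Q v)) M
    ≡⟨ sym (∑-+ _ _ M) ⟩
      ∑ (λ v → ind (r x v ∧ Q v) + ind (any (λ w → r w v) L ∧ (not (r x v) ∧ Q v))) M
    ≡⟨ ∑-cong M (λ v _ → sym (ind-∨-∧ (r x v) _ (Q v))) ⟩
      count (λ v → any (λ w → r w v) (x ∷ L) ∧ Q v) M ∎
    where
      open ≡-Reasoning
      -- A u dropped by deduplicate is related to x and adds nothing new; a kept u has a class disjoint from x's.
      outside-class : ∀ u → (if not (r x u) then count (λ v → r u v ∧ Q v) M else 0)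
                            ≡ count (λ v → r u v ∧ (not (r x v) ∧ Q v)) M
      outside-class u with R? x u
      ... | yes xRu = sym (trans (∑-cong M pointwise) (∑-const 0 M))
        where
          pointwise : ∀ v → v ∈ M → ind (r u v ∧ (not (r x v) ∧ Q v)) ≡ 0
          pointwise v _ with R? u v
          ... | no _    = refl
          ... | yes uRv rewrite dec-true (R? x v) (R-trans xRu uRv) = refl
      ... | no ¬xRu = ∑-cong M pointwise
        where
          pointwise : ∀ v → v ∈ M → ind (r u v ∧ Q v) ≡ ind (r u v ∧ (not (r x v) ∧ Q v))
          pointwise v _ with R? u v
          ... | no _    = refl
          ... | yes uRv rewrite dec-false (R? x v) (λ xRv → ¬xRu (R-trans xRv (R-sym uRv))) = refl

-- Rotation and negated reversal

module _ {A : Set} where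

  toList-injective : ∀ {n} (u v : Vec A n) → toList u ≡ toList v → u ≡ v
  toList-injective u v e = trans (sym (cast-is-id refl u)) (Vecₚ.toList-injective refl u v e)

  rot1ᴸ : List A → List A
  rot1ᴸ []       = []
  rot1ᴸ (x ∷ xs) = xs ++ x ∷ []

  rotᴸ : ℕ → List A → List A
  rotᴸ zero    xs = xs
  rotᴸ (suc j) xs = rot1ᴸ (rotᴸ j xs)

  rotᴸ-+ : ∀ a b (xs : List A) → rotᴸ (a + b) xs ≡ rotᴸ a (rotᴸ b xs)
  rotᴸ-+ zero    b xs = refl
  rotᴸ-+ (suc a) b xs = cong rot1ᴸ (rotᴸ-+ a b xs)

  rotᴸ-++ : ∀ (xs ys : List A) → rotᴸ (length xs) (xs ++ ys) ≡ ys ++ xs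
  rotᴸ-++ []       ys = sym (Listₚ.++-identityʳ ys)
  rotᴸ-++ (x ∷ xs) ys = begin
      rotᴸ (suc (length xs)) (x ∷ xs ++ ys)     ≡⟨ cong (λ j → rotᴸ j (x ∷ xs ++ ys)) (+-comm 1 (length xs)) ⟩
      rotᴸ (length xs + 1) (x ∷ xs ++ ys)       ≡⟨ rotᴸ-+ (length xs) 1 (x ∷ xs ++ ys) ⟩
      rotᴸ (length xs) ((xs ++ ys) ++ x ∷ [])   ≡⟨ cong (rotᴸ (length xs)) (Listₚ.++-assoc xs ys (x ∷ [])) ⟩
      rotᴸ (length xs) (xs ++ (ys ++ x ∷ []))   ≡⟨ rotᴸ-++ xs (ys ++ x ∷ []) ⟩
      (ys ++ x ∷ []) ++ xs                      ≡⟨ Listₚ.++-assoc ys (x ∷ []) xs ⟩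
      ys ++ x ∷ xs                              ∎
    where open ≡-Reasoning

  toList-rot1 : ∀ {n} (u : Vec A n) → toList (rot1 u) ≡ rot1ᴸ (toList u)
  toList-rot1 []       = refl
  toList-rot1 (x ∷ xs) = Vecₚ.toList-∷ʳ x xs

  toList-rot : ∀ {n} j (u : Vec A n) → toList (rot j u) ≡ rotᴸ j (toList u)
  toList-rot zero    u = refl
  toList-rot (suc j) u = trans (toList-rot1 (rot j u)) (cong rot1ᴸ (toList-rot j u))

  rot-+ : ∀ {n} a b (u : Vec A n) → rot (a + b) u ≡ rot a (rot b u)
  rot-+ zero    b u = refl
  rot-+ (suc a) b u = cong rot1 (rot-+ a b u)

  rot-comm : ∀ {n} a b (u : Vec A n) → rot a (rot b u) ≡ rot b (rot a u)
  rot-comm a b u = trans (sym (rot-+ a b u)) (trans (cong (λ j → rot j u) (+-comm a b)) (rot-+ b a u))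

  rot-suc : ∀ {n} j (u : Vec A n) → rot (suc j) u ≡ rot j (rot1 u)
  rot-suc j u = rot-comm 1 j u

  rot-length : ∀ {n} (u : Vec A n) → rot n u ≡ u
  rot-length {n} u = toList-injective (rot n u) u (begin
      toList (rot n u)                            ≡⟨ toList-rot n u ⟩
      rotᴸ n (toList u)                           ≡⟨ cong₂ rotᴸ (sym (Vecₚ.length-toList u)) (sym (Listₚ.++-identityʳ _)) ⟩
      rotᴸ (length (toList u)) (toList u ++ [])   ≡⟨ rotᴸ-++ (toList u) [] ⟩
      toList u                                    ∎)
    where open ≡-Reasoning

  rot1-injective : ∀ {n} (u v : Vec A n) → rot1 u ≡ rot1 v → u ≡ v
  rot1-injective []       []       _ = refl
  rot1-injective (x ∷ xs) (y ∷ ys) e with Vecₚ.∷ʳ-injective xs ys e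
  ... | xs≡ys , x≡y = cong₂ _∷_ x≡y xs≡ys

  rot-injective : ∀ {n} j (u v : Vec A n) → rot j u ≡ rot j v → u ≡ v
  rot-injective zero    u v e = e
  rot-injective (suc j) u v e = rot-injective j u v (rot1-injective (rot j u) (rot j v) e)

  rot-* : ∀ {n} c q (u : Vec A n) → rot c u ≡ u → rot (q * c) u ≡ u
  rot-* c zero    u _   = refl
  rot-* c (suc q) u c-u = trans (rot-+ c (q * c) u) (trans (cong (rot c) (rot-* c q u c-u)) c-u)

  rot-% : ∀ {n} c .{{_ : NonZero c}} (u : Vec A n) → rot c u ≡ u → ∀ a → rot a u ≡ rot (a % c) u
  rot-% c u c-u a = begin
      rot a u                           ≡⟨ cong (λ j → rot j u) (m≡m%n+[m/n]*n a c) ⟩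
      rot (a % c + a / c * c) u         ≡⟨ rot-+ (a % c) (a / c * c) u ⟩
      rot (a % c) (rot (a / c * c) u)   ≡⟨ cong (rot (a % c)) (rot-* c (a / c) u c-u) ⟩
      rot (a % c) u                     ∎
    where open ≡-Reasoning

neg-involutive : ∀ {k} (a : Fin k) → neg (neg a) ≡ a
neg-involutive zero    = refl
neg-involutive (suc i) = cong suc (opposite-involutive i)

module _ {k : ℕ} where

  negRevᴸ : List (Fin k) → List (Fin k)
  negRevᴸ xs = map neg (reverse xs)

  toList-negRev : ∀ {n} (u : Tuple k n) → toList (negRev u) ≡ negRevᴸ (toList u)
  toList-negRev u = trans (Vecₚ.toList-map neg (Vec.reverse u)) (cong (map neg) (Vecₚ.toList-reverse u))

  negRevᴸ-++ : ∀ xs ys → negRevᴸ (xs ++ ys) ≡ negRevᴸ ys ++ negRevᴸ xs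
  negRevᴸ-++ xs ys = trans (cong (map neg) (Listₚ.reverse-++ xs ys)) (Listₚ.map-++ neg (reverse ys) (reverse xs))


  negRevᴸ-involutive : ∀ xs → negRevᴸ (negRevᴸ xs) ≡ xs
  negRevᴸ-involutive xs = begin
      map neg (reverse (map neg (reverse xs)))   ≡⟨ cong (map neg) (sym (Listₚ.reverse-map neg (reverse xs))) ⟩
      map neg (map neg (reverse (reverse xs)))   ≡⟨ sym (Listₚ.map-∘ (reverse (reverse xs))) ⟩
      map (neg ∘ neg) (reverse (reverse xs))     ≡⟨ Listₚ.map-cong neg-involutive (reverse (reverse xs)) ⟩
      map (λ a → a) (reverse (reverse xs))       ≡⟨ Listₚ.map-id (reverse (reverse xs)) ⟩
      reverse (reverse xs)                       ≡⟨ Listₚ.reverse-involutive xs ⟩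
      xs                                         ∎
    where open ≡-Reasoning

  negRev-involutive : ∀ {n} (u : Tuple k n) → negRev (negRev u) ≡ u
  negRev-involutive u = toList-injective _ _
    (trans (toList-negRev (negRev u)) (trans (cong negRevᴸ (toList-negRev u)) (negRevᴸ-involutive (toList u))))

  rot1-negRev-rot1 : ∀ {n} (u : Tuple k n) → rot1 (negRev (rot1 u)) ≡ negRev u
  rot1-negRev-rot1 []       = refl
  rot1-negRev-rot1 (x ∷ xs) = toList-injective _ _ (begin
      toList (rot1 (negRev (xs Vec.∷ʳ x)))     ≡⟨ toList-rot1 (negRev (xs Vec.∷ʳ x)) ⟩
      rot1ᴸ (toList (negRev (xs Vec.∷ʳ x)))    ≡⟨ cong rot1ᴸ (toList-negRev (xs Vec.∷ʳ x)) ⟩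
      rot1ᴸ (negRevᴸ (toList (xs Vec.∷ʳ x)))   ≡⟨ cong (rot1ᴸ ∘ negRevᴸ) (Vecₚ.toList-∷ʳ x xs) ⟩
      rot1ᴸ (negRevᴸ (toList xs ++ x ∷ []))    ≡⟨ cong rot1ᴸ (negRevᴸ-++ (toList xs) (x ∷ [])) ⟩
      negRevᴸ (toList xs) ++ neg x ∷ []        ≡⟨ sym (negRevᴸ-++ (x ∷ []) (toList xs)) ⟩
      negRevᴸ (toList (x ∷ xs))                ≡⟨ sym (toList-negRev (x ∷ xs)) ⟩
      toList (negRev (x ∷ xs))                 ∎)
    where open ≡-Reasoning

  rot-negRev-rot : ∀ {n} j (u : Tuple k n) → rot j (negRev (rot j u)) ≡ negRev u
  rot-negRev-rot zero    u = refl
  rot-negRev-rot (suc j) u =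
    trans (rot-suc j _) (trans (cong (rot j) (rot1-negRev-rot1 (rot j u))) (rot-negRev-rot j u))

-- The period of a tuple

record IsLeast (P : ℕ → Set) (lo c : ℕ) : Set where
  field
    lower : lo ≤ c
    holds : P c
    least : ∀ {c′} → lo ≤ c′ → c′ < c → ¬ P c′

isLeast-at-lower : ∀ {P : ℕ → Set} {lo c} → c ≡ lo → P c → IsLeast P lo c
isLeast-at-lower refl Pc = record { lower = ≤-refl ; holds = Pc ; least = λ lo≤c′ c′<lo → ⊥-elim (<⇒≱ c′<lo lo≤c′) }

firstOr-filter-isLeast : ∀ {P : ℕ → Set} (P? : ∀ c → Dec (P c)) (f : ℕ → ℕ) s l →
  (∀ i → f i ≡ s + i) → P (s + l) → IsLeast P s (firstOr (s + l) (filter P? (applyUpTo f (suc l))))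
firstOr-filter-isLeast P? f s l f≗s+ P[s+l] with P? (f 0)
... | yes P[f0] = isLeast-at-lower (trans (f≗s+ 0) (+-identityʳ s)) P[f0]
firstOr-filter-isLeast P? f s zero    f≗s+ P[s+0] | no _ = isLeast-at-lower (+-identityʳ s) P[s+0]
firstOr-filter-isLeast {P} P? f s (suc l) f≗s+ P[s+1+l] | no ¬P[f0] = record
  { lower = ≤-trans (n≤1+n s) lower ; holds = holds ; least = least′ }
  where
    open IsLeast (subst (λ d → IsLeast P (suc s) (firstOr d (filter P? (applyUpTo (f ∘ suc) (suc l)))))
                        (sym (+-suc s l))
                        (firstOr-filter-isLeast P? (f ∘ suc) (suc s) l (λ i → trans (f≗s+ (suc i)) (+-suc s i))
                                                (subst P (+-suc s l) P[s+1+l])))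
    least′ : ∀ {c′} → s ≤ c′ → c′ < firstOr (s + suc l) (filter P? (applyUpTo (f ∘ suc) (suc l))) → ¬ P c′
    least′ s≤c c<p with m≤n⇒m<n∨m≡n s≤c
    ... | inj₁ s<c  = least s<c c<p
    ... | inj₂ refl = subst (λ c → ¬ P c) (trans (f≗s+ 0) (+-identityʳ s)) ¬P[f0]

module _ {A : Set} {n : ℕ} where

  rotations-below : ∀ c .{{_ : NonZero c}} {u v : Vec A n} → rot c u ≡ u →
                    Any (λ j → v ≡ rot j u) (upTo c) ⇔ ∃ λ j → v ≡ rot j u
  rotations-below c {u} c-u = mk⇔
    (λ v∈ → let j , _ , v≡ = Anyₚ.applyUpTo⁻ (λ i → i) v∈ in j , v≡)
    (λ (j , v≡) → Anyₚ.applyUpTo⁺ (λ i → i) (trans v≡ (rot-% c u c-u j)) (m%n<n j c))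

sameCircuit⇔ : ∀ {k n} {u v : Tuple k (suc n)} → SameCircuit u v ⇔ ∃ λ j → v ≡ rot j u
sameCircuit⇔ {u = u} = rotations-below _ (rot-length u)

module Period {k n : ℕ} (u : Tuple k (suc n)) where

  p : ℕ
  p = period u

  isLeast : IsLeast (λ c → rot c u ≡ u) 1 p
  isLeast = subst (λ xs → IsLeast (λ c → rot c u ≡ u) 1 (firstOr (suc n) (filter (λ c → rot c u ≟ᵛ u) xs)))
                  (sym (Listₚ.map-applyUpTo (λ i → i) suc (suc n)))
                  (firstOr-filter-isLeast (λ c → rot c u ≟ᵛ u) suc 1 n (λ i → refl) (rot-length u))

  open IsLeast isLeast public using () renaming (holds to rot-period)

  instance
    p-nonZero : NonZero p
    p-nonZero = >-nonZero (IsLeast.lower isLeast)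

  rot-%-period : ∀ a → rot a u ≡ rot (a % p) u
  rot-%-period = rot-% p u rot-period

  rot-injective-below : ∀ {i j} → i < j → j < p → rot i u ≢ rot j u
  rot-injective-below {i} {j} i<j j<p rotᵢ≡rotⱼ = IsLeast.least isLeast (m<n⇒0<n∸m i<j) (≤-<-trans (m∸n≤m j i) j<p)
    (rot-injective i _ _ (begin
      rot i (rot (j ∸ i) u)   ≡⟨ rot-comm i (j ∸ i) u ⟩
      rot (j ∸ i) (rot i u)   ≡⟨ sym (rot-+ (j ∸ i) i u) ⟩
      rot (j ∸ i + i) u       ≡⟨ cong (λ c → rot c u) (m∸n+n≡m (<⇒≤ i<j)) ⟩
      rot j u                 ≡⟨ sym rotᵢ≡rotⱼ ⟩
      rot i u                 ∎))
    where open ≡-Reasoning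

  rot≡⇒%≡ : ∀ a b → rot a u ≡ rot b u → a % p ≡ b % p
  rot≡⇒%≡ a b rot-a≡rot-b = compare (trans (sym (rot-%-period a)) (trans rot-a≡rot-b (rot-%-period b)))
    where
      compare : rot (a % p) u ≡ rot (b % p) u → a % p ≡ b % p
      compare e with <-cmp (a % p) (b % p)
      ... | tri< lt _ _ = ⊥-elim (rot-injective-below lt (m%n<n b p) e)
      ... | tri≈ _ eq _ = eq
      ... | tri> _ _ gt = ⊥-elim (rot-injective-below gt (m%n<n a p) (sym e))

  %≡⇒rot≡ : ∀ a b → a % p ≡ b % p → rot a u ≡ rot b u
  %≡⇒rot≡ a b eq = trans (rot-%-period a) (trans (cong (λ c → rot c u) eq) (sym (rot-%-period b)))

  rot≡id⇒period∣ : ∀ m → rot m u ≡ u → p ∣ m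
  rot≡id⇒period∣ m rotₘ≡u = m%n≡0⇒n∣m m p (trans (rot≡⇒%≡ m 0 rotₘ≡u) (m<n⇒m%n≡m (IsLeast.lower isLeast)))

  period∣⇒rot≡id : ∀ {m} → p ∣ m → rot m u ≡ u
  period∣⇒rot≡id (divides q refl) = rot-* p q u rot-period

  period∣length : p ∣ suc n
  period∣length = rot≡id⇒period∣ (suc n) (rot-length u)

  edges≡ : edges u ≡ applyUpTo (λ j → rot j u) p
  edges≡ = Listₚ.map-applyUpTo (λ i → i) (λ j → rot j u) p

  edges-unique : Unique (edges u)
  edges-unique = subst Unique (sym edges≡) (Uniqueₚ.applyUpTo⁺₁ (λ j → rot j u) p rot-injective-below)

  ∈-edges⇔ : ∀ {v} → v ∈ edges u ⇔ ∃ λ j → v ≡ rot j u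
  ∈-edges⇔ = ⇔.trans (mk⇔ Anyₚ.map⁻ Anyₚ.map⁺) (rotations-below p rot-period)

-- Parity, and halving modulo p

even : ℕ → Bool
even zero    = true
even (suc n) = not (even n)

data Parity : ℕ → Set where
  even-form : ∀ h → Parity (h + h)
  odd-form  : ∀ h → Parity (suc (h + h))

parity : ∀ y → Parity y
parity zero    = even-form 0
parity (suc y) with parity y
... | even-form h = odd-form h
... | odd-form h  = subst Parity (cong suc (+-suc h h)) (even-form (suc h))

even-double : ∀ h → even (h + h) ≡ true
even-double zero    = refl
even-double (suc h) = trans (cong (not ∘ even) (+-suc h h)) (trans (not-involutive _) (even-double h))

double-injective : ∀ {i j} → i + i ≡ j + j → i ≡ j
double-injective {i} {j} e with <-cmp i j
... | tri< i<j _ _ = ⊥-elim (<⇒≢ (+-mono-< i<j i<j) e)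
... | tri≈ _ i≡j _ = i≡j
... | tri> _ _ j<i = ⊥-elim (<⇒≢ (+-mono-< j<i j<i) (sym e))

double≢odd : ∀ i j → i + i ≢ suc (j + j)
double≢odd i j e with trans (sym (even-double i)) (trans (cong even e) (cong not (even-double j)))
... | ()

even-+ : ∀ a b → even (a + b) ≡ (if even a then even b else not (even b))
even-+ zero    b = refl
even-+ (suc a) b rewrite even-+ a b with even a
... | true  = refl
... | false = not-involutive (even b)

even-* : ∀ a b → even (a * b) ≡ even a ∨ even b
even-* zero    b = refl
even-* (suc a) b rewrite even-+ b (a * b) | even-* a b with even a | even b
... | true  | true  = refl
... | true  | false = refl
... | false | true  = refl
... | false | false = refl

double≡*2 : ∀ h → h + h ≡ h * 2
double≡*2 h = trans (cong (h +_) (sym (+-identityʳ h))) (*-comm 2 h)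

%2-even : ∀ y → y % 2 ≡ (if even y then 0 else 1)
%2-even y with parity y
... | even-form h rewrite even-double h = trans (cong (_% 2) (double≡*2 h)) (m*n%n≡0 h 2)
... | odd-form h  rewrite even-double h = trans (cong (λ z → suc z % 2) (double≡*2 h)) ([m+kn]%n≡m%n 1 h 2)

divisor-odd : ∀ {d m} → d ∣ m → even m ≡ false → even d ≡ false
divisor-odd {d} (divides q refl) odd-m with even d in even-d
... | false = refl
... | true with trans (sym odd-m) (trans (even-* q d) (trans (cong (even q ∨_) even-d) (∨-zeroʳ (even q))))
...   | ()

odd-divisor-∣-double : ∀ {d x} → d ∣ 2 * x → even d ≡ false → d ∣ x
odd-divisor-∣-double {d} {x} (divides q 2x≡qd) odd-d with parity q
... | even-form h = divides h (*-cancelˡ-≡ x (h * d) 2 (begin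
    2 * x           ≡⟨ 2x≡qd ⟩
    (h + h) * d     ≡⟨ *-distribʳ-+ d h h ⟩
    h * d + h * d   ≡⟨ cong (h * d +_) (sym (+-identityʳ (h * d))) ⟩
    2 * (h * d)     ∎))
  where open ≡-Reasoning
... | odd-form h with trans (sym (even-* 2 x)) (trans (cong even 2x≡qd) (trans (even-* (suc (h + h)) d)
                       (cong₂ _∨_ (cong not (even-double h)) odd-d)))
...   | ()

odd-divisor-∣-2^* : ∀ t {d m} → d ∣ 2 ^ t * m → even d ≡ false → d ∣ m
odd-divisor-∣-2^* zero    {d} {m} d∣m odd-d = subst (d ∣_) (+-identityʳ m) d∣m
odd-divisor-∣-2^* (suc t) {d} {m} d∣  odd-d =
  odd-divisor-∣-2^* t (odd-divisor-∣-double (subst (d ∣_) (*-assoc 2 (2 ^ t) m) d∣) odd-d) odd-d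

2^-suc : ∀ t → ∃ λ r → 2 ^ t ≡ suc r
2^-suc zero    = 0 , refl
2^-suc (suc t) with 2^-suc t
... | r , e = _ , cong (λ x → x + (x + 0)) e

half-double : ∀ h → (h + h) / 2 ≡ h
half-double h = trans (cong (_/ 2) (double≡*2 h)) (m*n/n≡m h 2)

count-double≡ : ∀ p y → y < p + p → count (λ j → does (j + j ≟ y)) (upTo p) ≡ ind (even y)
count-double≡ p y y<2p with parity y
... | even-form h = begin
    count (λ j → does (j + j ≟ h + h)) (upTo p)
  ≡⟨ ∑-cong (upTo p) (λ j _ → cong ind (does-⇔ (mk⇔ double-injective (cong (λ i → i + i))) (j + j ≟ h + h) (j ≟ h))) ⟩
    count (λ j → does (j ≟ h)) (upTo p)
  ≡⟨ count-≡-unique _≟_ (upTo⁺ p) (∈-upTo⁺ (≰⇒> (λ p≤h → <⇒≱ y<2p (+-mono-≤ p≤h p≤h)))) ⟩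
    1
  ≡⟨ cong ind (sym (even-double h)) ⟩
    ind (even (h + h)) ∎
  where open ≡-Reasoning
... | odd-form h rewrite even-double h =
  trans (∑-cong (upTo p) (λ j _ → cong ind (dec-false (j + j ≟ suc (h + h)) (double≢odd j h)))) (∑-const 0 (upTo p))

module _ (p : ℕ) {{p≢0 : NonZero p}} where

  -- Since y < 2p, y mod p is either y or y − p.
  ind-%≡ : ∀ {x y} → x < p → y < p + p → ind (does (y % p ≟ x)) ≡ ind (does (y ≟ x)) + ind (does (y ≟ x + p))
  ind-%≡ {x} {y} x<p y<2p with <-≤-connex y p
  ... | inj₁ y<p rewrite m<n⇒m%n≡m y<p | dec-false (y ≟ x + p) (<⇒≢ (<-≤-trans y<p (m≤n+m p x))) = sym (+-identityʳ _)
  ... | inj₂ p≤y = subst (λ y → ind (does (y % p ≟ x)) ≡ ind (does (y ≟ x)) + ind (does (y ≟ x + p)))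
                         (m∸n+n≡m p≤y) (shifted (y ∸ p) (+-cancelʳ-< p (y ∸ p) p (subst (_< p + p) (sym (m∸n+n≡m p≤y)) y<2p)))
    where
      shifted : ∀ d → d < p → ind (does ((d + p) % p ≟ x)) ≡ ind (does (d + p ≟ x)) + ind (does (d + p ≟ x + p))
      shifted d d<p rewrite [m+n]%n≡m%n d p {{p≢0}} | m<n⇒m%n≡m d<p
                          | dec-false (d + p ≟ x) (λ e → <⇒≱ x<p (subst (p ≤_) e (m≤n+m p d)))
        = cong ind (does-⇔ (mk⇔ (cong (_+ p)) (+-cancelʳ-≡ p d x)) (d ≟ x) (d + p ≟ x + p))

  halvings : ℕ → ℕ
  halvings x = count (λ j → does ((j + j) % p ≟ x)) (upTo p)

  halvings≡ : ∀ {x} → x < p → halvings x ≡ ind (even x) + ind (even (x + p))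
  halvings≡ {x} x<p = begin
      halvings x
    ≡⟨ ∑-cong (upTo p) (λ j j<p → ind-%≡ x<p (+-mono-< (∈-upTo⁻ j<p) (∈-upTo⁻ j<p))) ⟩
      ∑ (λ j → ind (does (j + j ≟ x)) + ind (does (j + j ≟ x + p))) (upTo p)
    ≡⟨ ∑-+ _ _ (upTo p) ⟩
      count (λ j → does (j + j ≟ x)) (upTo p) + count (λ j → does (j + j ≟ x + p)) (upTo p)
    ≡⟨ cong₂ _+_ (count-double≡ p x (<-≤-trans x<p (m≤m+n p p))) (count-double≡ p (x + p) (+-monoˡ-< p x<p)) ⟩
      ind (even x) + ind (even (x + p)) ∎
    where open ≡-Reasoning

  halvings-consecutive : ∀ s → halvings (s % p) + halvings (suc s % p) ≡ 2
  halvings-consecutive s = trans (cong (λ y → halvings (s % p) + halvings y) suc-s%p) (from-residue (m%n<n s p))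
    where
      r = s % p
      suc-s%p : suc s % p ≡ suc r % p
      suc-s%p = trans (cong (λ z → suc z % p) (m≡m%n+[m/n]*n s p)) ([m+kn]%n≡m%n (suc r) (s / p) p)
      wrap-around : ∀ b → ind b + ind false + (1 + ind (not b)) ≡ 2
      wrap-around true  = refl
      wrap-around false = refl
      from-residue : r < p → halvings r + halvings (suc r % p) ≡ 2
      from-residue r<p with m≤n⇒m<n∨m≡n r<p
      ... | inj₁ 1+r<p rewrite m<n⇒m%n≡m 1+r<p | halvings≡ r<p | halvings≡ 1+r<p =
        trans (interchange (ind (even r)) (ind (even (r + p))) _ _) (cong₂ _+_ (ind-not (even r)) (ind-not (even (r + p))))
      ... | inj₂ 1+r≡p = begin
          halvings r + halvings (suc r % p)
        ≡⟨ cong₂ _+_ (halvings≡ r<p) (trans (cong halvings (trans (cong (_% p) 1+r≡p) (n%n≡0 p)))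
                                            (halvings≡ (subst (0 <_) 1+r≡p z<s))) ⟩
          ind (even r) + ind (even (r + p)) + (1 + ind (even p))
        ≡⟨ cong₂ (λ a b → ind (even r) + ind a + (1 + ind b)) even[r+p] (cong even (sym 1+r≡p)) ⟩
          ind (even r) + ind false + (1 + ind (not (even r)))
        ≡⟨ wrap-around (even r) ⟩
          2 ∎
        where
          open ≡-Reasoning
          even[r+p] : even (r + p) ≡ false
          even[r+p] = trans (cong (λ q → even (r + q)) (sym 1+r≡p)) (trans (cong even (+-suc r r)) (cong not (even-double r)))

  halvings-odd : even p ≡ false → ∀ {x} → x < p → halvings x ≡ 1
  halvings-odd odd-p {x} x<p rewrite halvings≡ x<p | even-+ x p | odd-p with even x
  ... | true  = refl
  ... | false = refl

  halvings≡1⇒odd : ∀ {x} → x < p → halvings x ≡ 1 → even p ≡ false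
  halvings≡1⇒odd {x} x<p h≡1 with even p in even-p
  ... | false = refl
  ... | true  = ⊥-elim (not-one (trans (sym (halvings≡ x<p)) h≡1))
    where
      not-one : ind (even x) + ind (even (x + p)) ≢ 1
      not-one rewrite even-+ x p | even-p with even x
      ... | true  = λ ()
      ... | false = λ ()

-- The edges of one circuit

-- u = rot1 (−uᴿ) says that the first n − 1 entries of u form a negasymmetric tuple and the last one is its own negative.
NegSym₁ : ∀ {k n} → Tuple k n → Set
NegSym₁ u = rot1 (negRev u) ≡ u

negSymᵇ : ∀ {k n} → Tuple k n → Bool
negSymᵇ u = does (negSym? u)

negSym₁ᵇ : ∀ {k n} → Tuple k n → Bool
negSym₁ᵇ u = does (rot1 (negRev u) ≟ᵛ u)

periodicᵇ : ∀ {k n} → ℕ → Tuple k n → Bool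
periodicᵇ m u = does (rot m u ≟ᵛ u)

negSym₁⇒negRev≡rot : ∀ {k n} (v : Tuple k (suc n)) → NegSym₁ v → negRev v ≡ rot n v
negSym₁⇒negRev≡rot {n = n} v e = begin
    negRev v                  ≡⟨ sym (rot-length (negRev v)) ⟩
    rot (suc n) (negRev v)    ≡⟨ rot-suc n (negRev v) ⟩
    rot n (rot1 (negRev v))   ≡⟨ cong (rot n) e ⟩
    rot n v                   ∎
  where open ≡-Reasoning

split-two : ∀ a b → a + b ≡ 2 →
  a ≡ ind (does (a ≟ 1)) + 2 * ind (does (a ≟ 2)) × b ≡ 2 * ind (does (a ≟ 0)) + ind (does (a ≟ 1))
split-two 0 b a+b≡2 = refl , a+b≡2
split-two 1 b a+b≡2 = refl , suc-injective a+b≡2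
split-two 2 b a+b≡2 = refl , +-cancelˡ-≡ 2 b 0 a+b≡2
split-two (suc (suc (suc a))) b ()

module Circuit {k n : ℕ} (u : Tuple k (suc n)) where

  open Period u public

  negRev-rot : ∀ j {s} → negRev (rot j u) ≡ rot s (rot j u) → negRev u ≡ rot (j + (s + j)) u
  negRev-rot j {s} e = begin
      negRev u                   ≡⟨ sym (rot-negRev-rot j u) ⟩
      rot j (negRev (rot j u))   ≡⟨ cong (rot j) e ⟩
      rot j (rot s (rot j u))    ≡⟨ cong (rot j) (sym (rot-+ s j u)) ⟩
      rot j (rot (s + j) u)      ≡⟨ sym (rot-+ j (s + j) u) ⟩
      rot (j + (s + j)) u        ∎
    where open ≡-Reasoning

  negSymCircuit⇔ : NegSymCircuit u ⇔ ∃ λ s → negRev u ≡ rot s u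
  negSymCircuit⇔ = mk⇔ to from
    where
      to : NegSymCircuit u → ∃ λ s → negRev u ≡ rot s u
      to nsc with find nsc
      ... | a , a∈ , b-any with find b-any
      ... | b , b∈ , a≡-b with Equivalence.to ∈-edges⇔ a∈ | Equivalence.to ∈-edges⇔ b∈
      ... | i , refl | j , refl = j + i , (begin
          negRev u                 ≡⟨ sym (rot-negRev-rot j u) ⟩
          rot j (negRev (rot j u)) ≡⟨ cong (rot j) (sym a≡-b) ⟩
          rot j (rot i u)   ≡⟨ sym (rot-+ j i u) ⟩
          rot (j + i) u     ∎)
        where open ≡-Reasoning
      from : (∃ λ s → negRev u ≡ rot s u) → NegSymCircuit u
      from (s , e) = lose (Equivalence.from ∈-edges⇔ (s , refl)) (lose (Equivalence.from ∈-edges⇔ (0 , refl)) (sym e))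

  rot-twice⇔ : ∀ j {w t} → rot j w ≡ rot t u → (w ≡ rot j u ⇔ (j + j) % p ≡ t % p)
  rot-twice⇔ j {w} {t} rotⱼw≡ = mk⇔
    (λ w≡ → rot≡⇒%≡ (j + j) t (begin
      rot (j + j) u     ≡⟨ rot-+ j j u ⟩
      rot j (rot j u)   ≡⟨ cong (rot j) (sym w≡) ⟩
      rot j w           ≡⟨ rotⱼw≡ ⟩
      rot t u           ∎))
    (λ %≡ → rot-injective j w (rot j u) (begin
      rot j w           ≡⟨ rotⱼw≡ ⟩
      rot t u           ≡⟨ %≡⇒rot≡ t (j + j) (sym %≡) ⟩
      rot (j + j) u     ≡⟨ rot-+ j j u ⟩
      rot j (rot j u)   ∎))
    where open ≡-Reasoning

  count-edges : (f : Tuple k (suc n) → Bool) → count f (edges u) ≡ count (λ j → f (rot j u)) (upTo p)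
  count-edges f = ∑-map (ind ∘ f) (λ j → rot j u) (upTo p)

  module NegSymmetric (s : ℕ) (negRev≡rot : negRev u ≡ rot s u) where

    negSym-rot⇔ : ∀ j → NegSym (rot j u) ⇔ ((j + j) % p ≡ s % p)
    negSym-rot⇔ j = ⇔.trans (mk⇔ sym sym)
                      (rot-twice⇔ j (trans (rot-negRev-rot j u) negRev≡rot))

    negSym₁-rot⇔ : ∀ j → NegSym₁ (rot j u) ⇔ ((j + j) % p ≡ suc s % p)
    negSym₁-rot⇔ j = rot-twice⇔ j (begin
        rot j (rot1 (negRev (rot j u)))   ≡⟨ rot-comm j 1 _ ⟩
        rot1 (rot j (negRev (rot j u)))   ≡⟨ cong rot1 (rot-negRev-rot j u) ⟩
        rot1 (negRev u)                   ≡⟨ cong rot1 negRev≡rot ⟩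
        rot (suc s) u                     ∎)
      where open ≡-Reasoning

    count-negSym-edges : count negSymᵇ (edges u) ≡ halvings p (s % p)
    count-negSym-edges = trans (count-edges negSymᵇ) (∑-cong (upTo p) (λ j _ →
      cong ind (does-⇔ (negSym-rot⇔ j) (negSym? (rot j u)) ((j + j) % p ≟ s % p))))

    count-negSym₁-edges : count negSym₁ᵇ (edges u) ≡ halvings p (suc s % p)
    count-negSym₁-edges = trans (count-edges negSym₁ᵇ) (∑-cong (upTo p) (λ j _ →
      cong ind (does-⇔ (negSym₁-rot⇔ j) (rot1 (negRev (rot j u)) ≟ᵛ rot j u) ((j + j) % p ≟ suc s % p))))

    count-edges-sum : count negSymᵇ (edges u) + count negSym₁ᵇ (edges u) ≡ 2
    count-edges-sum = trans (cong₂ _+_ count-negSym-edges count-negSym₁-edges) (halvings-consecutive p s)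

    count-negSym-edges≡1⇔odd : count negSymᵇ (edges u) ≡ 1 ⇔ even p ≡ false
    count-negSym-edges≡1⇔odd = mk⇔
      (λ one → halvings≡1⇒odd p (m%n<n s p) (trans (sym count-negSym-edges) one))
      (λ odd-p → trans count-negSym-edges (halvings-odd p odd-p (m%n<n s p)))

  module NotNegSymmetric (¬nsc : ¬ NegSymCircuit u) where

    no-rotation : ∀ j {s} → negRev (rot j u) ≢ rot s (rot j u)
    no-rotation j {s} e = ¬nsc (Equivalence.from negSymCircuit⇔ (j + (s + j) , negRev-rot j e))

    count-negSym-edges : count negSymᵇ (edges u) ≡ 0
    count-negSym-edges = trans (count-edges negSymᵇ) (trans (∑-cong (upTo p) (λ j _ →
      cong ind (dec-false (negSym? (rot j u)) (no-rotation j {0} ∘ sym)))) (∑-const 0 (upTo p)))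

    count-negSym₁-edges : count negSym₁ᵇ (edges u) ≡ 0
    count-negSym₁-edges = trans (count-edges negSym₁ᵇ) (trans (∑-cong (upTo p) (λ j _ →
      cong ind (dec-false (_ ≟ᵛ _) (no-rotation j {n} ∘ negSym₁⇒negRev≡rot (rot j u))))) (∑-const 0 (upTo p)))

  periodic-rot : ∀ m j → periodicᵇ m (rot j u) ≡ periodicᵇ m u
  periodic-rot m j = does-⇔ (mk⇔ (λ e → rot-injective j _ _ (trans (rot-comm j m u) e))
                                 (λ e → trans (rot-comm m j u) (cong (rot j) e)))
                            (rot m (rot j u) ≟ᵛ rot j u) (rot m u ≟ᵛ u)

  count-periodic-edges : ∀ m → count (λ e → negSymᵇ e ∧ periodicᵇ m e) (edges u)
                               ≡ (if periodicᵇ m u then count negSymᵇ (edges u) else 0)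
  count-periodic-edges m = trans (∑-cong (edges u) on-edge) (count-∧-const negSymᵇ (periodicᵇ m u) (edges u))
    where
      on-edge : ∀ e → e ∈ edges u → ind (negSymᵇ e ∧ periodicᵇ m e) ≡ ind (negSymᵇ e ∧ periodicᵇ m u)
      on-edge e e∈ with Equivalence.to ∈-edges⇔ e∈
      ... | j , refl = cong (λ c → ind (negSymᵇ (rot j u) ∧ c)) (periodic-rot m j)

  numNegSymEdges≡ : numNegSymEdges u ≡ count negSymᵇ (edges u)
  numNegSymEdges≡ = length-filter negSym? (edges u)

  inN : ℕ → Bool
  inN i = does (negSymCircuit? u ×-dec (numNegSymEdges u ≟ i))

  edge-counts : count negSymᵇ (edges u) ≡ ind (inN 1) + 2 * ind (inN 2)
              × count negSym₁ᵇ (edges u) ≡ 2 * ind (inN 0) + ind (inN 1)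
  edge-counts with negSymCircuit? u
  ... | no ¬nsc = NotNegSymmetric.count-negSym-edges ¬nsc , NotNegSymmetric.count-negSym₁-edges ¬nsc
  ... | yes nsc rewrite numNegSymEdges≡ =
    split-two _ _ (NegSymmetric.count-edges-sum (proj₁ witness) (proj₂ witness))
    where witness = Equivalence.to negSymCircuit⇔ nsc

  module _ {m} (odd-m : even m ≡ false) (odd-divisors : ∀ {d} → d ∣ suc n → even d ≡ false → d ∣ m) where

    period∣m⇔odd : p ∣ m ⇔ even p ≡ false
    period∣m⇔odd = mk⇔ (λ p∣m → divisor-odd p∣m odd-m) (odd-divisors period∣length)

    -- Both sides say that p is odd: p ∣ n, and the odd divisors of n are those of m.
    count-negSym-edges≡1⇔periodic : NegSymCircuit u → count negSymᵇ (edges u) ≡ 1 ⇔ rot m u ≡ u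
    count-negSym-edges≡1⇔periodic nsc = mk⇔
      (period∣⇒rot≡id ∘ Equivalence.from period∣m⇔odd ∘ Equivalence.to count-negSym-edges≡1⇔odd)
      (Equivalence.from count-negSym-edges≡1⇔odd ∘ Equivalence.to period∣m⇔odd ∘ rot≡id⇒period∣ m)
      where
        witness = Equivalence.to negSymCircuit⇔ nsc
        open NegSymmetric (proj₁ witness) (proj₂ witness)

    period∣m : NegSymCircuit u → numNegSymEdges u ≡ 1 → p ∣ m
    period∣m nsc one = rot≡id⇒period∣ m (Equivalence.to (count-negSym-edges≡1⇔periodic nsc) (trans (sym numNegSymEdges≡) one))

    count-periodic-negSym-edges : count (λ e → negSymᵇ e ∧ periodicᵇ m e) (edges u) ≡ ind (inN 1)
    count-periodic-negSym-edges rewrite count-periodic-edges m with negSymCircuit? u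
    ... | no ¬nsc with periodicᵇ m u
    ...   | true  = NotNegSymmetric.count-negSym-edges ¬nsc
    ...   | false = refl
    count-periodic-negSym-edges | yes nsc rewrite numNegSymEdges≡ with rot m u ≟ᵛ u
    ...   | yes periodic rewrite Equivalence.from (count-negSym-edges≡1⇔periodic nsc) periodic = refl
    ...   | no aperiodic = sym (cong ind (dec-false (_ ≟ 1) (aperiodic ∘ Equivalence.to (count-negSym-edges≡1⇔periodic nsc))))

-- Counting negasymmetric tuples

count-≡-∧-allTuples : ∀ k n (z : Tuple k n) b → count (λ y → does (y ≟ᵛ z) ∧ b) (allTuples k n) ≡ ind b
count-≡-∧-allTuples k n z b = begin
    count (λ y → does (y ≟ᵛ z) ∧ b) (allTuples k n)
  ≡⟨ count-∧-const (λ y → does (y ≟ᵛ z)) b (allTuples k n) ⟩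
    (if b then count (λ y → does (y ≟ᵛ z)) (allTuples k n) else 0)
  ≡⟨ cong (λ c → if b then c else 0) (count-≡-allTuples k n z) ⟩
    (if b then 1 else 0)
  ≡⟨ trans (if-then-0 b 1) (*-identityˡ (ind b)) ⟩
    ind b ∎
  where open ≡-Reasoning

module _ {k : ℕ} where

  toList-negRev-++ : ∀ {a b} (x : Tuple k a) (w : Tuple k b) →
                     toList (negRev (x Vec.++ w)) ≡ toList (negRev w) ++ toList (negRev x)
  toList-negRev-++ x w = begin
      toList (negRev (x Vec.++ w))               ≡⟨ toList-negRev (x Vec.++ w) ⟩
      negRevᴸ (toList (x Vec.++ w))              ≡⟨ cong negRevᴸ (Vecₚ.toList-++ x w) ⟩
      negRevᴸ (toList x ++ toList w)             ≡⟨ negRevᴸ-++ (toList x) (toList w) ⟩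
      negRevᴸ (toList w) ++ negRevᴸ (toList x)   ≡⟨ sym (cong₂ _++_ (toList-negRev w) (toList-negRev x)) ⟩
      toList (negRev w) ++ toList (negRev x)     ∎
    where open ≡-Reasoning

  negRev-++ : ∀ {h} (x y : Tuple k h) → negRev (x Vec.++ y) ≡ negRev y Vec.++ negRev x
  negRev-++ x y = toList-injective _ _ (trans (toList-negRev-++ x y) (sym (Vecₚ.toList-++ (negRev y) (negRev x))))

  negRev-++-∷ : ∀ {h} (x y : Tuple k h) c → negRev (x Vec.++ c ∷ y) ≡ negRev y Vec.++ neg c ∷ negRev x
  negRev-++-∷ x y c = toList-injective _ _ (begin
      toList (negRev (x Vec.++ c ∷ y))                         ≡⟨ toList-negRev-++ x (c ∷ y) ⟩
      toList (negRev (c ∷ y)) ++ toList (negRev x)             ≡⟨ cong (_++ toList (negRev x)) (toList-negRev-++ (c ∷ []) y) ⟩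
      (toList (negRev y) ++ neg c ∷ []) ++ toList (negRev x)   ≡⟨ Listₚ.++-assoc (toList (negRev y)) (neg c ∷ []) _ ⟩
      toList (negRev y) ++ neg c ∷ toList (negRev x)           ≡⟨ sym (Vecₚ.toList-++ (negRev y) (neg c ∷ negRev x)) ⟩
      toList (negRev y Vec.++ neg c ∷ negRev x)                ∎)
    where open ≡-Reasoning

  rot1-negRev-++-[] : ∀ {h} (w : Tuple k h) d → rot1 (negRev (w Vec.++ d ∷ [])) ≡ negRev w Vec.++ neg d ∷ []
  rot1-negRev-++-[] w d = toList-injective _ _ (begin
      toList (rot1 (negRev (w Vec.++ d ∷ [])))    ≡⟨ toList-rot1 (negRev (w Vec.++ d ∷ [])) ⟩
      rot1ᴸ (toList (negRev (w Vec.++ d ∷ [])))   ≡⟨ cong rot1ᴸ (toList-negRev-++ w (d ∷ [])) ⟩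
      toList (negRev w) ++ neg d ∷ []             ≡⟨ sym (Vecₚ.toList-++ (negRev w) (neg d ∷ [])) ⟩
      toList (negRev w Vec.++ neg d ∷ [])         ∎)
    where open ≡-Reasoning

  negSym-++⇔ : ∀ {h} (x y : Tuple k h) → NegSym (x Vec.++ y) ⇔ y ≡ negRev x
  negSym-++⇔ x y = mk⇔
    (λ ns → proj₂ (Vecₚ.++-injective x (negRev y) (trans ns (negRev-++ x y))))
    (λ { refl → trans (cong (Vec._++ negRev x) (sym (negRev-involutive x))) (sym (negRev-++ x (negRev x))) })

  negSym-++-∷⇔ : ∀ {h} (x y : Tuple k h) c → NegSym (x Vec.++ c ∷ y) ⇔ (y ≡ negRev x × c ≡ neg c)
  negSym-++-∷⇔ x y c = mk⇔
    (λ ns → let c∷y≡ = proj₂ (Vecₚ.++-injective x (negRev y) (trans ns (negRev-++-∷ x y c)))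
            in Vecₚ.∷-injectiveʳ c∷y≡ , Vecₚ.∷-injectiveˡ c∷y≡)
    (λ { (refl , c≡-c) → trans (cong₂ (λ x′ c′ → x′ Vec.++ c′ ∷ negRev x) (sym (negRev-involutive x)) c≡-c)
                               (sym (negRev-++-∷ x (negRev x) c)) })

  negSym₁-++-[]⇔ : ∀ {h} (w : Tuple k h) d → NegSym₁ (w Vec.++ d ∷ []) ⇔ (d ≡ neg d × NegSym w)
  negSym₁-++-[]⇔ w d = mk⇔
    (λ ns₁ → let w≡ , d≡ = Vecₚ.++-injective (negRev w) w (trans (sym (rot1-negRev-++-[] w d)) ns₁)
             in sym (Vecₚ.∷-injectiveˡ d≡) , sym w≡)
    (λ (d≡-d , ns) → trans (rot1-negRev-++-[] w d) (cong₂ (λ w′ d′ → w′ Vec.++ d′ ∷ []) (sym ns) (sym d≡-d)))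

++-injective-length : ∀ {A : Set} (xs ys : List A) {zs ws} → length xs ≡ length ys → xs ++ zs ≡ ys ++ ws → xs ≡ ys × zs ≡ ws
++-injective-length []       []       _ e = refl , e
++-injective-length (x ∷ xs) (y ∷ ys) l e with ++-injective-length xs ys (suc-injective l) (Listₚ.∷-injectiveʳ e)
... | xs≡ys , zs≡ws = cong₂ _∷_ (Listₚ.∷-injectiveˡ e) xs≡ys , zs≡ws

module _ {A : Set} where

  rep : ∀ {m} q → Vec A m → Vec A (q * m)
  rep q b = Vec.concat (Vec.replicate q b)

  rep-comm : ∀ {m} q (b : Vec A m) → toList (rep q b) ++ toList b ≡ toList b ++ toList (rep q b)
  rep-comm zero    b = sym (Listₚ.++-identityʳ _)
  rep-comm (suc q) b = begin
      toList (b Vec.++ rep q b) ++ lb   ≡⟨ cong (_++ lb) (Vecₚ.toList-++ b (rep q b)) ⟩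
      (lb ++ toList (rep q b)) ++ lb    ≡⟨ Listₚ.++-assoc lb _ lb ⟩
      lb ++ (toList (rep q b) ++ lb)    ≡⟨ cong (lb ++_) (rep-comm q b) ⟩
      lb ++ (lb ++ toList (rep q b))    ≡⟨ cong (lb ++_) (sym (Vecₚ.toList-++ b (rep q b))) ⟩
      lb ++ toList (b Vec.++ rep q b)   ∎
    where
      open ≡-Reasoning
      lb = toList b

  commuting⇒rep : ∀ {m} q (b : Vec A m) (w : Vec A (q * m)) →
                  toList w ++ toList b ≡ toList b ++ toList w → w ≡ rep q b
  commuting⇒rep zero        b []  _ = refl
  commuting⇒rep {m} (suc q) b w e with Vec.splitAt m w
  ... | w₁ , w₂ , refl =
    cong₂ Vec._++_ w₁≡b (commuting⇒rep q b w₂ (trans (proj₂ split) (cong (_++ toList w₂) (proj₁ split))))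
    where
      lw₁ = toList w₁
      lw₂ = toList w₂
      lb  = toList b
      split : lw₁ ≡ lb × lw₂ ++ lb ≡ lw₁ ++ lw₂
      split = ++-injective-length lw₁ lb (trans (Vecₚ.length-toList w₁) (sym (Vecₚ.length-toList b))) (begin
          lw₁ ++ (lw₂ ++ lb)            ≡⟨ sym (Listₚ.++-assoc lw₁ lw₂ lb) ⟩
          (lw₁ ++ lw₂) ++ lb            ≡⟨ cong (_++ lb) (sym (Vecₚ.toList-++ w₁ w₂)) ⟩
          toList (w₁ Vec.++ w₂) ++ lb   ≡⟨ e ⟩
          lb ++ toList (w₁ Vec.++ w₂)   ≡⟨ cong (lb ++_) (Vecₚ.toList-++ w₁ w₂) ⟩
          lb ++ (lw₁ ++ lw₂)            ∎)
        where open ≡-Reasoning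
      w₁≡b : w₁ ≡ b
      w₁≡b = toList-injective w₁ b (proj₁ split)

  toList-rot-++ : ∀ {m N} (b : Vec A m) (w : Vec A N) → toList (rot m (b Vec.++ w)) ≡ toList w ++ toList b
  toList-rot-++ {m} b w = begin
      toList (rot m (b Vec.++ w))    ≡⟨ toList-rot m (b Vec.++ w) ⟩
      rotᴸ m (toList (b Vec.++ w))   ≡⟨ cong₂ rotᴸ (sym (Vecₚ.length-toList b)) (Vecₚ.toList-++ b w) ⟩
      rotᴸ (length (toList b)) (toList b ++ toList w) ≡⟨ rotᴸ-++ (toList b) (toList w) ⟩
      toList w ++ toList b                               ∎
    where open ≡-Reasoning

  periodic-++⇔ : ∀ {m} q (b : Vec A m) (w : Vec A (q * m)) → rot m (b Vec.++ w) ≡ b Vec.++ w ⇔ w ≡ rep q b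
  periodic-++⇔ q b w = mk⇔
    (λ per → commuting⇒rep q b w (trans (sym (toList-rot-++ b w)) (trans (cong toList per) (Vecₚ.toList-++ b w))))
    (λ { refl → toList-injective _ _ (trans (toList-rot-++ b (rep q b))
                  (trans (rep-comm q b) (sym (Vecₚ.toList-++ b (rep q b))))) })

module _ {k : ℕ} where

  negRev-rep : ∀ {m} q (b : Tuple k m) → negRev (rep q b) ≡ rep q (negRev b)
  negRev-rep zero    b = refl
  negRev-rep (suc q) b = toList-injective _ _ (begin
      toList (negRev (b Vec.++ rep q b))               ≡⟨ toList-negRev-++ b (rep q b) ⟩
      toList (negRev (rep q b)) ++ toList (negRev b)   ≡⟨ cong (λ r → toList r ++ toList (negRev b)) (negRev-rep q b) ⟩
      toList (rep q (negRev b)) ++ toList (negRev b)   ≡⟨ rep-comm q (negRev b) ⟩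
      toList (negRev b) ++ toList (rep q (negRev b))   ≡⟨ sym (Vecₚ.toList-++ (negRev b) (rep q (negRev b))) ⟩
      toList (negRev b Vec.++ rep q (negRev b))        ∎)
    where open ≡-Reasoning

  negSym-rep⇔ : ∀ {m} q (b : Tuple k m) → NegSym (b Vec.++ rep q b) ⇔ NegSym b
  negSym-rep⇔ q b = mk⇔
    (λ ns → Vecₚ.++-injectiveˡ b (negRev b) (trans ns (negRev-rep (suc q) b)))
    (λ ns → trans (cong (λ c → c Vec.++ rep q c) ns) (sym (negRev-rep (suc q) b)))

module _ (k : ℕ) where

  -- a = −a in ℤ_k holds for a = 0 and, when k is even, for a = k/2.
  selfNeg : ℕ
  selfNeg = count (λ c → does (c ≟ᶠ neg c)) (allFin k)

  count-negSym-even : ∀ h → count negSymᵇ (allTuples k (h + h)) ≡ k ^ h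
  count-negSym-even h = begin
      count negSymᵇ (allTuples k (h + h))
    ≡⟨ ∑-allTuples-++ k h (ind ∘ negSymᵇ) ⟩
      ∑ (λ x → count (λ y → negSymᵇ (x Vec.++ y)) (allTuples k h)) (allTuples k h)
    ≡⟨ ∑-cong (allTuples k h) (λ x _ → trans (∑-cong (allTuples k h) (λ y _ →
         cong ind (does-⇔ (negSym-++⇔ x y) (negSym? (x Vec.++ y)) (y ≟ᵛ negRev x)))) (count-≡-allTuples k h (negRev x))) ⟩
      ∑ (λ _ → 1) (allTuples k h)
    ≡⟨ trans (∑-const-allTuples k h 1) (*-identityˡ (k ^ h)) ⟩
      k ^ h ∎
    where open ≡-Reasoning

  count-negSym-odd : ∀ h → count negSymᵇ (allTuples k (h + suc h)) ≡ selfNeg * k ^ h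
  count-negSym-odd h = begin
      count negSymᵇ (allTuples k (h + suc h))
    ≡⟨ ∑-allTuples-++ k h (ind ∘ negSymᵇ) ⟩
      ∑ (λ x → count (λ w → negSymᵇ (x Vec.++ w)) (allTuples k (suc h))) (allTuples k h)
    ≡⟨ ∑-cong (allTuples k h) (λ x _ → trans (∑-allTuples-suc k (ind ∘ negSymᵇ ∘ (x Vec.++_)))
                                             (∑-cong (allFin k) (λ c _ → middle x c))) ⟩
      ∑ (λ _ → selfNeg) (allTuples k h)
    ≡⟨ ∑-const-allTuples k h selfNeg ⟩
      selfNeg * k ^ h ∎
    where
      open ≡-Reasoning
      middle : ∀ x c → count (λ y → negSymᵇ (x Vec.++ c ∷ y)) (allTuples k h) ≡ ind (does (c ≟ᶠ neg c))
      middle x c = trans (∑-cong (allTuples k h) (λ y _ → cong ind (does-⇔ (negSym-++-∷⇔ x y c)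
                           (negSym? (x Vec.++ c ∷ y)) ((y ≟ᵛ negRev x) ×-dec (c ≟ᶠ neg c)))))
                         (count-≡-∧-allTuples k h (negRev x) (does (c ≟ᶠ neg c)))

  count-negSym₁ : ∀ h → count negSym₁ᵇ (allTuples k (h + 1)) ≡ selfNeg * count negSymᵇ (allTuples k h)
  count-negSym₁ h = begin
      count negSym₁ᵇ (allTuples k (h + 1))
    ≡⟨ ∑-allTuples-++ k h (ind ∘ negSym₁ᵇ) ⟩
      ∑ (λ w → count (λ v → negSym₁ᵇ (w Vec.++ v)) (allTuples k 1)) (allTuples k h)
    ≡⟨ ∑-cong (allTuples k h) (λ w _ → trans (∑-allTuples-suc k (ind ∘ negSym₁ᵇ ∘ (w Vec.++_))) (last w)) ⟩
      ∑ (λ w → selfNeg * ind (negSymᵇ w)) (allTuples k h)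
    ≡⟨ ∑-*ˡ selfNeg (ind ∘ negSymᵇ) (allTuples k h) ⟩
      selfNeg * count negSymᵇ (allTuples k h) ∎
    where
      open ≡-Reasoning
      last : ∀ w → ∑ (λ d → ind (negSym₁ᵇ (w Vec.++ d ∷ [])) + 0) (allFin k) ≡ selfNeg * ind (negSymᵇ w)
      last w = begin
          ∑ (λ d → ind (negSym₁ᵇ (w Vec.++ d ∷ [])) + 0) (allFin k)
        ≡⟨ ∑-cong (allFin k) (λ d _ → trans (+-identityʳ _) (cong ind (does-⇔ (negSym₁-++-[]⇔ w d)
             (rot1 (negRev (w Vec.++ d ∷ [])) ≟ᵛ (w Vec.++ d ∷ [])) ((d ≟ᶠ neg d) ×-dec negSym? w)))) ⟩
          count (λ d → does (d ≟ᶠ neg d) ∧ negSymᵇ w) (allFin k)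
        ≡⟨ count-∧-const (λ d → does (d ≟ᶠ neg d)) (negSymᵇ w) (allFin k) ⟩
          (if negSymᵇ w then selfNeg else 0)
        ≡⟨ if-then-0 (negSymᵇ w) selfNeg ⟩
          selfNeg * ind (negSymᵇ w) ∎

  count-negSym-periodic : ∀ m q → count (λ v → negSymᵇ v ∧ periodicᵇ m v) (allTuples k (m + q * m))
                                  ≡ count negSymᵇ (allTuples k m)
  count-negSym-periodic m q = trans (∑-allTuples-++ k m _) (∑-cong (allTuples k m) (λ b _ →
    trans (∑-cong (allTuples k (q * m)) (λ w _ → cong ind (does-⇔ (characterisation b w)
                     (negSym? (b Vec.++ w) ×-dec (rot m (b Vec.++ w) ≟ᵛ (b Vec.++ w))) ((w ≟ᵛ rep q b) ×-dec negSym? b))))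
          (count-≡-∧-allTuples k (q * m) (rep q b) (negSymᵇ b))))
    where
      characterisation : ∀ b w → (NegSym (b Vec.++ w) × rot m (b Vec.++ w) ≡ b Vec.++ w) ⇔ (w ≡ rep q b × NegSym b)
      characterisation b w = mk⇔
        (λ (ns , per) → let w≡ = Equivalence.to (periodic-++⇔ q b w) per
                        in w≡ , Equivalence.to (negSym-rep⇔ q b) (subst (λ w → NegSym (b Vec.++ w)) w≡ ns))
        (λ { (refl , ns) → Equivalence.from (negSym-rep⇔ q b) ns , Equivalence.from (periodic-++⇔ q b w) refl })

opposite-fixed⇔ : ∀ {k} (i : Fin k) → i ≡ opposite i ⇔ suc (toℕ i + toℕ i) ≡ k
opposite-fixed⇔ {k} i = mk⇔
  (λ i≡ → begin
      suc (toℕ i + toℕ i)             ≡⟨ cong (λ t → suc (toℕ i + t)) (trans (cong toℕ i≡) (opposite-prop i)) ⟩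
      suc (toℕ i) + (k ∸ suc (toℕ i)) ≡⟨ m+[n∸m]≡n (toℕ<n i) ⟩
      k                               ∎)
  (λ 2i+1≡k → toℕ-injective (sym (begin
      toℕ (opposite i)                    ≡⟨ opposite-prop i ⟩
      k ∸ suc (toℕ i)                     ≡⟨ cong (_∸ suc (toℕ i)) (sym 2i+1≡k) ⟩
      suc (toℕ i + toℕ i) ∸ suc (toℕ i)   ≡⟨ m+n∸m≡n (toℕ i) (toℕ i) ⟩
      toℕ i                               ∎)))
  where open ≡-Reasoning

count-opposite-fixed : ∀ k → count (λ i → does (i ≟ᶠ opposite i)) (allFin k) ≡ ind (not (even k))
count-opposite-fixed k with parity k
... | even-form h rewrite even-double h = trans (∑-cong (allFin (h + h)) (λ i _ →
        cong ind (dec-false (i ≟ᶠ opposite i) (double≢odd h (toℕ i) ∘ sym ∘ Equivalence.to (opposite-fixed⇔ i)))))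
      (∑-const 0 (allFin (h + h)))
... | odd-form h rewrite even-double h = trans (∑-cong (allFin (suc (h + h))) (λ i _ →
        cong ind (does-⇔ (fixed⇔ i) (i ≟ᶠ opposite i) (i ≟ᶠ fromℕ< h<k))))
      (count-≡-unique _≟ᶠ_ (allFin⁺ (suc (h + h))) (∈-allFin (fromℕ< h<k)))
  where
    h<k : h < suc (h + h)
    h<k = s≤s (m≤m+n h h)
    fixed⇔ : ∀ i → i ≡ opposite i ⇔ i ≡ fromℕ< h<k
    fixed⇔ i = ⇔.trans (opposite-fixed⇔ i) (mk⇔
      (λ e → toℕ-injective (trans (double-injective (suc-injective e)) (sym (toℕ-fromℕ< h<k))))
      (λ { refl → cong (λ t → suc (t + t)) (toℕ-fromℕ< h<k) }))

δ≡ : ∀ k → δ k ≡ (if even k then 2 else 1)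
δ≡ k with even k in even-k
... | true  rewrite %2-even k | even-k = refl
... | false rewrite %2-even k | even-k = refl

selfNeg≡δ : ∀ k → selfNeg (suc k) ≡ δ (suc k)
selfNeg≡δ k = begin
    selfNeg (suc k)
  ≡⟨ cong (λ xs → 1 + ∑ (ind ∘ (λ c → does (c ≟ᶠ neg c))) xs) (sym (Listₚ.map-tabulate {n = k} (λ i → i) suc)) ⟩
    1 + count (λ c → does (c ≟ᶠ neg c)) (map suc (allFin k))
  ≡⟨ cong suc (trans (∑-map _ suc (allFin k)) (count-opposite-fixed k)) ⟩
    suc (ind (not (even k)))
  ≡⟨ last (even k) ⟩
    (if not (even k) then 2 else 1)
  ≡⟨ sym (δ≡ (suc k)) ⟩
    δ (suc k) ∎
  where
    open ≡-Reasoning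
    last : ∀ b → suc (ind (not b)) ≡ (if not b then 2 else 1)
    last true  = refl
    last false = refl

-- Summing over the circuits of H_k(n−1)

∑-↭ : ∀ {A : Set} (f : A → ℕ) {xs ys} → xs ↭ ys → ∑ f xs ≡ ∑ f ys
∑-↭ f xs↭ys = sum-↭ (↭ₚ.map⁺ f xs↭ys)

rot1ᴸ-↭ : ∀ {A : Set} (xs : List A) → rot1ᴸ xs ↭ xs
rot1ᴸ-↭ []       = ↭-refl
rot1ᴸ-↭ (x ∷ xs) = ↭ₚ.++-comm xs (x ∷ [])

pw2-neg : ∀ {k} (a : Fin k) → pw2 (neg a) + pw2 a ≡ k + k
pw2-neg zero = refl
pw2-neg {suc k} (suc i) = begin
    2 * suc (toℕ (opposite i)) + 2 * suc (toℕ i)   ≡⟨ sym (*-distribˡ-+ 2 (suc (toℕ (opposite i))) (suc (toℕ i))) ⟩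
    2 * (suc (toℕ (opposite i)) + suc (toℕ i))     ≡⟨ cong (λ t → 2 * suc (t + suc (toℕ i))) (opposite-prop i) ⟩
    2 * suc (k ∸ suc (toℕ i) + suc (toℕ i))        ≡⟨ cong (λ t → 2 * suc t) (m∸n+n≡m (toℕ<n i)) ⟩
    2 * suc k                                      ≡⟨ cong (suc k +_) (+-identityʳ (suc k)) ⟩
    suc k + suc k                                  ∎
  where open ≡-Reasoning

module _ {k : ℕ} where

  pseudoweight2-rot : ∀ {n} j (u : Tuple k n) → pseudoweight2 (rot j u) ≡ pseudoweight2 u
  pseudoweight2-rot zero    u = refl
  pseudoweight2-rot (suc j) u = trans (cong (∑ pw2) (toList-rot1 (rot j u)))
                                      (trans (∑-↭ pw2 (rot1ᴸ-↭ (toList (rot j u)))) (pseudoweight2-rot j u))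

  pseudoweight2-negRev : ∀ {n} (u : Tuple k n) → pseudoweight2 (negRev u) + pseudoweight2 u ≡ k * n + k * n
  pseudoweight2-negRev {n} u = begin
      ∑ pw2 (toList (negRev u)) + ∑ pw2 l
    ≡⟨ cong (_+ ∑ pw2 l) (trans (cong (∑ pw2) (toList-negRev u)) (∑-map pw2 neg (reverse l))) ⟩
      ∑ (pw2 ∘ neg) (reverse l) + ∑ pw2 l
    ≡⟨ cong (_+ ∑ pw2 l) (∑-↭ (pw2 ∘ neg) (↭ₚ.↭-reverse l)) ⟩
      ∑ (pw2 ∘ neg) l + ∑ pw2 l
    ≡⟨ sym (∑-+ (pw2 ∘ neg) pw2 l) ⟩
      ∑ (λ a → pw2 (neg a) + pw2 a) l
    ≡⟨ trans (∑-cong l (λ a _ → pw2-neg a)) (∑-const (k + k) l) ⟩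
      (k + k) * length l
    ≡⟨ cong ((k + k) *_) (Vecₚ.length-toList u) ⟩
      (k + k) * n
    ≡⟨ *-distribʳ-+ n k k ⟩
      k * n + k * n ∎
    where
      open ≡-Reasoning
      l = toList u

  negSym⇒inH : ∀ {n} (u : Tuple k n) → NegSym u → InH u
  negSym⇒inH u ns = double-injective (trans (cong (λ v → pseudoweight2 v + pseudoweight2 u) ns) (pseudoweight2-negRev u))

  negSym₁⇒inH : ∀ {n} (u : Tuple k n) → NegSym₁ u → InH u
  negSym₁⇒inH u ns₁ = double-injective (trans (cong (_+ pseudoweight2 u) pw≡) (pseudoweight2-negRev u))
    where
      pw≡ : pseudoweight2 u ≡ pseudoweight2 (negRev u)
      pw≡ = trans (cong pseudoweight2 (sym ns₁)) (pseudoweight2-rot 1 (negRev u))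

∈-allTuples : ∀ {k n} (v : Tuple k n) → v ∈ allTuples k n
∈-allTuples []      = here refl
∈-allTuples (c ∷ v) = ∈-concatMap⁺ _ (lose (∈-allFin c) (∈-map⁺ (c ∷_) (∈-allTuples v)))

does-any? : ∀ {A : Set} {P : A → Set} (P? : ∀ x → Dec (P x)) xs → does (any? P? xs) ≡ any (does ∘ P?) xs
does-any? P? []       = refl
does-any? P? (x ∷ xs) = cong (does (P? x) ∨_) (does-any? P? xs)

module Circuits (k n : ℕ) where

  private
    T = Tuple k (suc n)
    M = allTuples k (suc n)
    L = filter inH? M

  sameCircuit-sym : ∀ {u v : T} → SameCircuit u v → SameCircuit v u
  sameCircuit-sym {u} {v} sc with Equivalence.to sameCircuit⇔ sc
  ... | j , refl = Equivalence.from sameCircuit⇔ (j * n , (begin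
      u                       ≡⟨ sym (rot-* (suc n) j u (rot-length u)) ⟩
      rot (j * suc n) u       ≡⟨ cong (λ c → rot c u) (trans (*-suc j n) (+-comm j (j * n))) ⟩
      rot (j * n + j) u       ≡⟨ rot-+ (j * n) j u ⟩
      rot (j * n) (rot j u)   ∎))
    where open ≡-Reasoning

  sameCircuit-trans : ∀ {u v w : T} → SameCircuit u v → SameCircuit v w → SameCircuit u w
  sameCircuit-trans {u} uv vw with Equivalence.to sameCircuit⇔ uv | Equivalence.to sameCircuit⇔ vw
  ... | i , refl | j , refl = Equivalence.from sameCircuit⇔ (j + i , sym (rot-+ j i u))

  any-sameCircuit : ∀ v → any (λ w → does (sameCircuit? w v)) L ≡ does (inH? v)
  any-sameCircuit v = trans (sym (does-any? (λ w → sameCircuit? w v) L))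
                            (does-⇔ (mk⇔ to from) (any? (λ w → sameCircuit? w v) L) (inH? v))
    where
      to : Any (λ w → SameCircuit w v) L → InH v
      to any-sc with find any-sc
      ... | w , w∈L , sc with Equivalence.to sameCircuit⇔ sc
      ... | j , refl = trans (pseudoweight2-rot j w) (proj₂ (∈-filter⁻ inH? {xs = M} w∈L))
      from : InH v → Any (λ w → SameCircuit w v) L
      from inH = lose (∈-filter⁺ inH? (∈-allTuples v) inH) (Equivalence.from sameCircuit⇔ (0 , refl))

  count-edges-class : ∀ (Q : T → Bool) u → count Q (edges u) ≡ count (λ v → does (sameCircuit? u v) ∧ Q v) M
  count-edges-class Q u = trans (count-unique Q (Period.edges-unique u)) (∑-cong M (λ v _ →
      cong (λ b → ind (b ∧ Q v)) (does-⇔ (⇔.trans (Period.∈-edges⇔ u) (⇔.sym sameCircuit⇔))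
                                          (v ∈? edges u) (sameCircuit? u v))))
    where
      open Enumeration _≟ᵛ_ M (count-≡-allTuples k (suc n))
      open DecMembership _≟ᵛ_ using (_∈?_)

  circuit-sum : ∀ (Q : T → Bool) → (∀ v → Q v ≡ true → InH v) →
                ∑ (λ u → count Q (edges u)) (circuits k (suc n)) ≡ count Q M
  circuit-sum Q Q⇒inH = begin
      ∑ (λ u → count Q (edges u)) (circuits k (suc n))
    ≡⟨ ∑-cong (circuits k (suc n)) (λ u _ → count-edges-class Q u) ⟩
      ∑ (λ u → count (λ v → does (sameCircuit? u v) ∧ Q v) M) (deduplicate sameCircuit? L)
    ≡⟨ ∑-count-deduplicate sameCircuit? sameCircuit-sym sameCircuit-trans M L Q ⟩
      count (λ v → any (λ w → does (sameCircuit? w v)) L ∧ Q v) M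
    ≡⟨ ∑-cong M (λ v _ → cong (λ b → ind (b ∧ Q v)) (any-sameCircuit v)) ⟩
      count (λ v → does (inH? v) ∧ Q v) M
    ≡⟨ ∑-cong M (λ v _ → cong ind (inH-∧ v)) ⟩
      count Q M ∎
    where
      open ≡-Reasoning
      inH-∧ : ∀ v → does (inH? v) ∧ Q v ≡ Q v
      inH-∧ v with Q v in Qv
      ... | true  = trans (cong (_∧ true) (dec-true (inH? v) (Q⇒inH v Qv))) refl
      ... | false = ∧-zeroʳ _

  S : ℕ → ℕ
  S i = count (λ u → Circuit.inN u i) (circuits k (suc n))

  length-N : ∀ i → length (N i k (suc n)) ≡ S i
  length-N i = length-filter _ (circuits k (suc n))

  negSym-sum : S 1 + 2 * S 2 ≡ count negSymᵇ M
  negSym-sum = begin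
      S 1 + 2 * S 2
    ≡⟨ cong (S 1 +_) (sym (∑-*ˡ 2 _ (circuits k (suc n)))) ⟩
      S 1 + ∑ (λ u → 2 * ind (Circuit.inN u 2)) (circuits k (suc n))
    ≡⟨ sym (∑-+ _ _ (circuits k (suc n))) ⟩
      ∑ (λ u → ind (Circuit.inN u 1) + 2 * ind (Circuit.inN u 2)) (circuits k (suc n))
    ≡⟨ sym (∑-cong (circuits k (suc n)) (λ u _ → proj₁ (Circuit.edge-counts u))) ⟩
      ∑ (λ u → count negSymᵇ (edges u)) (circuits k (suc n))
    ≡⟨ circuit-sum negSymᵇ (λ v ns → negSym⇒inH v (does≡true⇒ (negSym? v) ns)) ⟩
      count negSymᵇ M ∎
    where open ≡-Reasoning

  negSym₁-sum : 2 * S 0 + S 1 ≡ count negSym₁ᵇ M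
  negSym₁-sum = begin
      2 * S 0 + S 1
    ≡⟨ cong (_+ S 1) (sym (∑-*ˡ 2 _ (circuits k (suc n)))) ⟩
      ∑ (λ u → 2 * ind (Circuit.inN u 0)) (circuits k (suc n)) + S 1
    ≡⟨ sym (∑-+ _ _ (circuits k (suc n))) ⟩
      ∑ (λ u → 2 * ind (Circuit.inN u 0) + ind (Circuit.inN u 1)) (circuits k (suc n))
    ≡⟨ sym (∑-cong (circuits k (suc n)) (λ u _ → proj₂ (Circuit.edge-counts u))) ⟩
      ∑ (λ u → count negSym₁ᵇ (edges u)) (circuits k (suc n))
    ≡⟨ circuit-sum negSym₁ᵇ (λ v ns₁ → negSym₁⇒inH v (does≡true⇒ (_ ≟ᵛ v) ns₁)) ⟩
      count negSym₁ᵇ M ∎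
    where open ≡-Reasoning

  periodic-sum : ∀ {m} → even m ≡ false → (∀ {d} → d ∣ suc n → even d ≡ false → d ∣ m) →
                 S 1 ≡ count (λ v → negSymᵇ v ∧ periodicᵇ m v) M
  periodic-sum {m} odd-m odd-divisors = begin
      S 1
    ≡⟨ sym (∑-cong (circuits k (suc n)) (λ u _ → Circuit.count-periodic-negSym-edges u odd-m odd-divisors)) ⟩
      ∑ (λ u → count (λ v → negSymᵇ v ∧ periodicᵇ m v) (edges u)) (circuits k (suc n))
    ≡⟨ circuit-sum _ (λ v e → negSym⇒inH v (does≡true⇒ (negSym? v) (∧-conicalˡ _ _ e))) ⟩
      count (λ v → negSymᵇ v ∧ periodicᵇ m v) M ∎
    where open ≡-Reasoning

-- n = 2ᵗm with t > 0 and m odd, written as n = 2(h + 1) = (q + 1)m with m = 2hm + 1.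
record OddPart (n m : ℕ) : Set where
  field
    hm           : ℕ
    m≡           : m ≡ hm + suc hm
    h            : ℕ
    n≡           : n ≡ suc h + suc h
    q            : ℕ
    n≡m+qm       : n ≡ m + q * m
    odd-divisors : ∀ {d} → d ∣ n → even d ≡ false → d ∣ m

  odd-m : even m ≡ false
  odd-m = trans (cong even (trans m≡ (+-suc hm hm))) (cong not (even-double hm))

  half-m : (m ∸ 1) / 2 ≡ hm
  half-m = trans (cong (λ x → (x ∸ 1) / 2) (trans m≡ (+-suc hm hm))) (half-double hm)

  half-n∸2 : (n ∸ 2) / 2 ≡ h
  half-n∸2 = trans (cong (λ x → (x ∸ 2) / 2) (trans n≡ (cong suc (+-suc h h)))) (half-double h)

  half-n : n / 2 ≡ suc h
  half-n = trans (cong (_/ 2) n≡) (half-double (suc h))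

oddPart : ∀ t m → m % 2 ≡ 1 → OddPart (2 ^ suc t * m) m
oddPart t m m%2≡1 with parity m
... | even-form hm with trans (sym m%2≡1) (trans (%2-even (hm + hm)) (cong (λ b → if b then 0 else 1) (even-double hm)))
...   | ()
oddPart t m m%2≡1 | odd-form hm with 2^-suc t | 2^-suc (suc t)
... | r , 2^t≡ | q , 2^[1+t]≡ = record
  { hm           = hm
  ; m≡           = sym (+-suc hm hm)
  ; h            = hm + hm + r * m
  ; n≡           = trans (*-assoc 2 (2 ^ t) m) (trans (cong (λ x → x * m + (x * m + 0)) 2^t≡) (cong (H +_) (+-identityʳ H)))
  ; q            = q
  ; n≡m+qm       = cong (_* m) 2^[1+t]≡
  ; odd-divisors = odd-divisor-∣-2^* (suc t)
  }
  where H = suc r * m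

module CircuitCounts (k n m : ℕ) (shape : OddPart (suc n) m) where

  open OddPart shape public
  open Circuits (suc k) n public

  private
    K = suc k

  S₁≡ : S 1 ≡ δ K * K ^ hm
  S₁≡ = begin
      S 1
    ≡⟨ periodic-sum odd-m odd-divisors ⟩
      count (λ v → negSymᵇ v ∧ periodicᵇ m v) (allTuples K (suc n))
    ≡⟨ cong (λ ℓ → count (λ v → negSymᵇ {K} {ℓ} v ∧ periodicᵇ m v) (allTuples K ℓ)) n≡m+qm ⟩
      count (λ v → negSymᵇ v ∧ periodicᵇ m v) (allTuples K (m + q * m))
    ≡⟨ count-negSym-periodic K m q ⟩
      count negSymᵇ (allTuples K m)
    ≡⟨ cong (λ ℓ → count negSymᵇ (allTuples K ℓ)) m≡ ⟩
      count negSymᵇ (allTuples K (hm + suc hm))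
    ≡⟨ count-negSym-odd K hm ⟩
      selfNeg K * K ^ hm
    ≡⟨ cong (_* K ^ hm) (selfNeg≡δ k) ⟩
      δ K * K ^ hm ∎
    where open ≡-Reasoning

  S₁+2S₂≡ : S 1 + 2 * S 2 ≡ K ^ suc h
  S₁+2S₂≡ = begin
      S 1 + 2 * S 2                                 ≡⟨ negSym-sum ⟩
      count negSymᵇ (allTuples K (suc n))           ≡⟨ cong (λ ℓ → count negSymᵇ (allTuples K ℓ)) n≡ ⟩
      count negSymᵇ (allTuples K (suc h + suc h))   ≡⟨ count-negSym-even K (suc h) ⟩
      K ^ suc h                                     ∎
    where open ≡-Reasoning

  2S₀+S₁≡ : 2 * S 0 + S 1 ≡ δ K * (δ K * K ^ h)
  2S₀+S₁≡ = begin
      2 * S 0 + S 1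
    ≡⟨ negSym₁-sum ⟩
      count negSym₁ᵇ (allTuples K (suc n))
    ≡⟨ cong (λ ℓ → count negSym₁ᵇ (allTuples K ℓ)) (trans n≡ (+-comm 1 (h + suc h))) ⟩
      count negSym₁ᵇ (allTuples K (h + suc h + 1))
    ≡⟨ count-negSym₁ K (h + suc h) ⟩
      selfNeg K * count negSymᵇ (allTuples K (h + suc h))
    ≡⟨ cong (selfNeg K *_) (count-negSym-odd K h) ⟩
      selfNeg K * (selfNeg K * K ^ h)
    ≡⟨ cong (λ c → c * (c * K ^ h)) (selfNeg≡δ k) ⟩
      δ K * (δ K * K ^ h) ∎
    where open ≡-Reasoning

  count-N₀ : 2 * length (N 0 K (suc n)) + δ K * K ^ ((m ∸ 1) / 2) ≡ δ K * (δ K * K ^ ((suc n ∸ 2) / 2))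
  count-N₀ rewrite length-N 0 | half-m | half-n∸2 = trans (cong (2 * S 0 +_) (sym S₁≡)) 2S₀+S₁≡

  count-N₁ : length (N 1 K (suc n)) ≡ δ K * K ^ ((m ∸ 1) / 2)
  count-N₁ rewrite length-N 1 | half-m = S₁≡

  count-N₂ : 2 * length (N 2 K (suc n)) + δ K * K ^ ((m ∸ 1) / 2) ≡ K ^ (suc n / 2)
  count-N₂ rewrite length-N 2 | half-m | half-n = trans (cong (2 * S 2 +_) (sym S₁≡)) (trans (+-comm (2 * S 2) (S 1)) S₁+2S₂≡)

  period∣m : (u : Tuple K (suc n)) → InH u → NegSymCircuit u → numNegSymEdges u ≡ 1 → period u ∣ m
  period∣m u _ = Circuit.period∣m u odd-m odd-divisors

lemma4p12 : (k n t m : ℕ) → 3 ≤ k → 4 ≤ n → 0 < t → n ≡ 2 ^ t * m → m % 2 ≡ 1 →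
    (2 * length (N 0 k n) + δ k * k ^ ((m ∸ 1) / 2) ≡ δ k * (δ k * k ^ ((n ∸ 2) / 2)))
    × (length (N 1 k n) ≡ δ k * k ^ ((m ∸ 1) / 2)
       × ((u : Tuple k n) → InH u → NegSymCircuit u → numNegSymEdges u ≡ 1 → period u ∣ m))
    × (2 * length (N 2 k n) + δ k * k ^ ((m ∸ 1) / 2) ≡ k ^ (n / 2))
lemma4p12 zero    _       _       _ () _  _  _  _
lemma4p12 (suc k) zero    _       _ _  () _  _  _
lemma4p12 (suc k) (suc n) zero    _ _  _  () _  _
lemma4p12 (suc k) (suc n) (suc t) m _  _  _  n≡ m%2≡1 = count-N₀ , (count-N₁ , period∣m) , count-N₂
  where open CircuitCounts k n m (subst (λ ℓ → OddPart ℓ m) (sym n≡) (oddPart t m m%2≡1))
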